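{- Let $k$ be a positive integer, and let $T$ be a tree with $ex(T)=1$ such that $\ell_1,\ell_2,\ldots,\ell_\alpha$ are the terminal vertices of the exterior major vertex $v$ of $T$. Then $\dim_{k,f}(T)=\dim_f(T)$ if and only if $d(v,\ell_i)\le k$ for each $i\in\{1,2,\ldots,\alpha\}$.
   Context: $d(x,y)$ denotes the distance. For $g$ defined on $V(T)$ and $U\subseteq V(T)$, $g(U)=\sum_{s\in U}g(s)$. For distinct $x,y$, $R\{x,y\}=\{z: d(x,z)\ne d(y,z)\}$; $g:V(T)\to[0,1]$ is a resolving function if $g(R\{x,y\})\ge1$ for all distinct $x,y$; $\dim_f(T)$ is the minimum of $g(V(T))$ over resolving functions. For a positive integer $k$, $d_k(x,y)=\min\{d(x,y),k+1\}$, $R_k\{x,y\}=\{z: d_k(x,z)\neq d_k(y,z)\}$; $h:V(T)\to[0,1]$ is a $k$-truncated resolving function if $h(R_k\{x,y\})\ge1$ for all distinct $x,y$; $\dim_{k,f}(T)$ is the minimum of $h(V(T))$ over such $h$. In a tree $T$: a leaf has degree 1, a major vertex has degree at least 3. A leaf $\ell$ is a terminal vertex of a major vertex $v$ if $d(\ell,v)<d(\ell,w)$ for every other major vertex $w$. The terminal degree of $v$ is its number of terminal vertices; an exterior major vertex is a major vertex with at least one terminal vertex, and $ex(T)$ is the number of exterior major vertices.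
   Formalization: The resolving functions and $k$-truncated resolving functions take rational values in [0,1] rather than real ones, so $\dim_f(T)$ and $\dim_{k,f}(T)$ are minima over rational-valued functions. -}

module Defs where

open import Data.Nat as ℕ using (ℕ; zero; suc; _⊓_; _∸_)
open import Data.Bool using (Bool; true; false; _∧_; _∨_; not; if_then_else_; T)
open import Data.Fin using (Fin; _≟_)
open import Relation.Nullary.Decidable using (⌊_⌋)
open import Data.List using (List; foldr; allFin)
open import Data.Bool.ListAction using (any)
open import Data.Rational as ℚ using (ℚ; 0ℚ; 1ℚ)
open import Data.Product using (Σ; _×_; ∃)
open import Relation.Binary.PropositionalEquality using (_≡_; _≢_)

Adj : ℕ → Set
Adj n = Fin n → Fin n → Bool

module _ {n : ℕ} (adj : Adj n) where

  sumℕ : (Fin n → ℕ) → ℕ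
  sumℕ f = foldr (λ z acc → f z ℕ.+ acc) 0 (allFin n)

  deg : Fin n → ℕ
  deg v = sumℕ (λ u → if adj v u then 1 else 0)

  reach : ℕ → Fin n → Fin n → Bool
  reach zero    x y = ⌊ x ≟ y ⌋
  reach (suc m) x y = reach m x y ∨ any (λ z → reach m x z ∧ adj z y) (allFin n)

  -- least m ≤ n with reach m x y (distance in a connected graph on n vertices)
  distFrom : ℕ → ℕ → Fin n → Fin n → ℕ
  distFrom m zero    x y = m
  distFrom m (suc f) x y = if reach m x y then m else distFrom (suc m) f x y

  d : Fin n → Fin n → ℕ
  d x y = distFrom 0 n x y

  IsTree : Set
  IsTree = (∀ x y → adj x y ≡ adj y x)
         × (∀ x → adj x x ≡ false)
         × (∀ x y → T (reach n x y))
         × (1 ℕ.≤ n)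
         × (sumℕ deg ≡ 2 ℕ.* (n ∸ 1))              -- |E| = |V| - 1

  IsLeaf : Fin n → Set
  IsLeaf ℓ = deg ℓ ≡ 1

  IsMajor : Fin n → Set
  IsMajor v = 3 ℕ.≤ deg v

  IsTerminal : Fin n → Fin n → Set
  IsTerminal v ℓ = IsMajor v × IsLeaf ℓ × (∀ w → IsMajor w → w ≢ v → d ℓ v ℕ.< d ℓ w)

  IsExteriorMajor : Fin n → Set
  IsExteriorMajor v = IsMajor v × ∃ (IsTerminal v)

  weightOn : (Fin n → Bool) → (Fin n → ℚ) → ℚ
  weightOn P g = foldr (λ z acc → if P z then g z ℚ.+ acc else acc) 0ℚ (allFin n)

  weight : (Fin n → ℚ) → ℚ
  weight g = weightOn (λ _ → true) g

  _≢ᵇ_ : ℕ → ℕ → Bool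
  a ≢ᵇ b = not (a ℕ.≡ᵇ b)

  R : Fin n → Fin n → Fin n → Bool
  R x y z = d x z ≢ᵇ d y z

  d[_] : ℕ → Fin n → Fin n → ℕ
  d[ k ] x y = d x y ⊓ suc k

  R[_] : ℕ → Fin n → Fin n → Fin n → Bool
  R[ k ] x y z = d[ k ] x z ≢ᵇ d[ k ] y z

  InUnit : (Fin n → ℚ) → Set
  InUnit g = ∀ z → (0ℚ ℚ.≤ g z) × (g z ℚ.≤ 1ℚ)

  IsResolvingFunction : (Fin n → ℚ) → Set
  IsResolvingFunction g = InUnit g × (∀ x y → x ≢ y → 1ℚ ℚ.≤ weightOn (R x y) g)

  IsTruncResolvingFunction : ℕ → (Fin n → ℚ) → Set
  IsTruncResolvingFunction k h = InUnit h × (∀ x y → x ≢ y → 1ℚ ℚ.≤ weightOn (R[ k ] x y) h)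

  IsFracDim : ℚ → Set
  IsFracDim r = Σ (Fin n → ℚ) (λ g → IsResolvingFunction g × weight g ≡ r)
              × (∀ g → IsResolvingFunction g → r ℚ.≤ weight g)

  IsTruncFracDim : ℕ → ℚ → Set
  IsTruncFracDim k s = Σ (Fin n → ℚ) (λ h → IsTruncResolvingFunction k h × weight h ≡ s)
                     × (∀ h → IsTruncResolvingFunction k h → s ℚ.≤ weight h)

{-# OPTIONS --safe #-}
module Submission where

-- Since v is the only exterior major vertex, it is the only major vertex: a major vertex w ≠ v
-- farthest from v would have, beyond one of its children, a leaf whose nearest major vertex is w.
-- Hence every branch of T at a neighbour u of v is a path (a leg). Any two vertices are told apart by
-- two different neighbours of v, and, when every leg has length at most k, still after truncating
-- distances at k + 1; so ½ on the neighbours of v is a (k-truncated) resolving function. Conversely a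
-- resolving function gives total weight at least 1 to every two branches, hence weight at least
-- deg(v)/2, which is therefore dim_f(T). If some leg is longer than k, its vertices at distance k and
-- k + 1 from v are separated under d_k only by v and their own branch, so that branch together with v
-- carries weight 1 and the truncated dimension exceeds deg(v)/2.
--
-- The tree axioms enter only through the handshake identity: counting adjacent pairs in the layering
-- by distance from a root shows that no edge stays inside a layer and that every vertex other than the
-- root has exactly one neighbour in the layer below.

open import Algebra.Bundles using (CommutativeMonoid)
open import Data.Bool using (Bool; true; false; _∧_; not; if_then_else_; T)
import Data.Bool.Properties as Bool
open import Data.Bool.ListAction using (any)
open import Data.Empty using (⊥; ⊥-elim)
open import Data.Fin using (Fin; _≟_)
import Data.Fin as Fin
import Data.Fin.Properties as Fin
open import Data.List using (allFin; foldr; tabulate)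
open import Data.List.Membership.Propositional.Properties using (∈-allFin)
import Data.List.Relation.Unary.Any as Any
import Data.List.Relation.Unary.Any.Properties as Anyₚ
open import Data.Nat using (ℕ; zero; suc; _+_; _*_; _∸_; _≤_; _<_; z≤n; s≤s; _<?_)
import Data.Nat as ℕ
open import Data.Nat.Induction using (<-rec)
import Data.Nat.Properties as ℕP
open import Data.Nat.Tactic.RingSolver using (solve-∀)
open import Data.Product using (_×_; ∃; ∃₂; _,_; proj₁; proj₂)
open import Data.Rational as ℚ using (ℚ; 0ℚ; 1ℚ; ½)
import Data.Rational.Properties as ℚP
open import Data.Sum using (_⊎_; inj₁; inj₂)
open import Data.Vec.Functional using (Vector)
open import Function using (_∘_; id; case_of_)
open import Function.Bundles using (_⇔_; mk⇔; Equivalence)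
open import Level using (0ℓ)
open import Relation.Binary.Definitions using (tri<; tri≈; tri>)
open import Relation.Binary.PropositionalEquality
open import Relation.Nullary using (¬_; yes; no; Dec; ¬?; _×-dec_; _⊎-dec_)
open import Relation.Nullary.Decidable using (⌊_⌋; decidable-stable; toWitness)

open import Defs

∧-≡true⁻ : ∀ {a b} → (a ∧ b) ≡ true → a ≡ true × b ≡ true
∧-≡true⁻ {true} {true} _ = refl , refl

≢⇒≢ᵇ : ∀ {a b} → a ≢ b → not (a ℕ.≡ᵇ b) ≡ true
≢⇒≢ᵇ {a} {b} a≢b with a ℕ.≡ᵇ b in eq
... | false = refl
... | true  = ⊥-elim (a≢b (ℕP.≡ᵇ⇒≡ a b (subst T (sym eq) _)))

≢ᵇ⇒≢ : ∀ {a b} → not (a ℕ.≡ᵇ b) ≡ true → a ≢ b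
≢ᵇ⇒≢ {a} ≢ᵇ refl rewrite Equivalence.to Bool.T-≡ (ℕP.≡⇒≡ᵇ a a refl) = case ≢ᵇ of λ ()

any-allFin⁻ : ∀ {n} (p : Fin n → Bool) → any p (allFin n) ≡ true → ∃ λ z → p z ≡ true
any-allFin⁻ {n} p e with Any.satisfied (Anyₚ.any⁻ p (allFin n) (Equivalence.from Bool.T-≡ e))
... | z , pz = z , Equivalence.to Bool.T-≡ pz

any-allFin⁺ : ∀ {n} (p : Fin n → Bool) z → p z ≡ true → any p (allFin n) ≡ true
any-allFin⁺ p z pz = Equivalence.to Bool.T-≡ (Anyₚ.any⁺ p (Any.map (λ { refl → Equivalence.from Bool.T-≡ pz }) (∈-allFin z)))

module Walks {n : ℕ} (adj : Adj n) where

  Reach : ℕ → Fin n → Fin n → Set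
  Reach m x y = reach adj m x y ≡ true

  reach-suc : ∀ m x y → Reach m x y → Reach (suc m) x y
  reach-suc m x y r rewrite r = refl

  reach-zero⇒≡ : ∀ x y → Reach 0 x y → x ≡ y
  reach-zero⇒≡ x y r with x ≟ y
  ... | yes x≡y = x≡y

  reach-refl : ∀ x → Reach 0 x x
  reach-refl x with x ≟ x
  ... | yes _ = refl
  ... | no x≢x = ⊥-elim (x≢x refl)

  reach-snoc : ∀ m x z y → Reach m x z → adj z y ≡ true → Reach (suc m) x y
  reach-snoc m x z y r e with reach adj m x y
  ... | true  = refl
  ... | false = any-allFin⁺ (λ w → reach adj m x w ∧ adj w y) z (cong₂ _∧_ r e)

  reach-unsnoc : ∀ m x y → Reach (suc m) x y →
                 Reach m x y ⊎ ∃ λ z → Reach m x z × adj z y ≡ true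
  reach-unsnoc m x y r with reach adj m x y in r′
  ... | true  = inj₁ refl
  ... | false with any-allFin⁻ _ r
  ...   | z , e = inj₂ (z , ∧-≡true⁻ e)

  reach-cons : ∀ m x x′ y → adj x x′ ≡ true → Reach m x′ y → Reach (suc m) x y
  reach-cons zero x x′ y e r rewrite reach-zero⇒≡ x′ y r = reach-snoc 0 x x y (reach-refl x) e
  reach-cons (suc m) x x′ y e r with reach-unsnoc m x′ y r
  ... | inj₁ r′            = reach-suc (suc m) x y (reach-cons m x x′ y e r′)
  ... | inj₂ (z , r′ , e′) = reach-snoc (suc m) x z y (reach-cons m x x′ z e r′) e′

  distFrom-minimal : ∀ m f x y j → Reach j x y → m ≤ j → distFrom adj m f x y ≤ j
  distFrom-minimal m zero    x y j r m≤j = m≤j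
  distFrom-minimal m (suc f) x y j r m≤j with reach adj m x y in rₘ
  ... | true = m≤j
  ... | false with m ℕP.≟ j
  ...   | yes refl = case trans (sym rₘ) r of λ ()
  ...   | no m≢j   = distFrom-minimal (suc m) f x y j r (ℕP.≤∧≢⇒< m≤j m≢j)

  distFrom-reaches : ∀ m f x y → Reach (m + f) x y → Reach (distFrom adj m f x y) x y
  distFrom-reaches m zero    x y r rewrite ℕP.+-identityʳ m = r
  distFrom-reaches m (suc f) x y r with reach adj m x y in rₘ
  ... | true  = rₘ
  ... | false = distFrom-reaches (suc m) f x y (subst (λ t → Reach t x y) (ℕP.+-suc m f) r)

module Distance {n : ℕ} (adj : Adj n) (adj-sym : ∀ x y → adj x y ≡ adj y x)
                (connected : ∀ x y → T (reach adj n x y)) where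
  open Walks adj

  d-reaches : ∀ x y → Reach (d adj x y) x y
  d-reaches x y = distFrom-reaches 0 n x y (Equivalence.to Bool.T-≡ (connected x y))

  d-minimal : ∀ j x y → Reach j x y → d adj x y ≤ j
  d-minimal j x y r = distFrom-minimal 0 n x y j r z≤n

  d≤n : ∀ x y → d adj x y ≤ n
  d≤n x y = d-minimal n x y (Equivalence.to Bool.T-≡ (connected x y))

  d-refl : ∀ x → d adj x x ≡ 0
  d-refl x = ℕP.n≤0⇒n≡0 (d-minimal 0 x x (reach-refl x))

  d≡0⇒≡ : ∀ x y → d adj x y ≡ 0 → x ≡ y
  d≡0⇒≡ x y d≡0 = reach-zero⇒≡ x y (subst (λ t → Reach t x y) d≡0 (d-reaches x y))

  d-last-step : ∀ m x y → d adj x y ≡ suc m → ∃ λ z → adj z y ≡ true × d adj x z ≡ m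
  d-last-step m x y d≡1+m with reach-unsnoc m x y (subst (λ t → Reach t x y) d≡1+m (d-reaches x y))
  ... | inj₁ r = ⊥-elim (ℕP.<-irrefl refl (ℕP.≤-trans (ℕP.≤-reflexive (sym d≡1+m)) (d-minimal m x y r)))
  ... | inj₂ (z , r , e) = z , e , ℕP.≤-antisym (d-minimal m x z r) (ℕP.≮⇒≥ shorter)
    where
    shorter : d adj x z < m → ⊥
    shorter lt = ℕP.<-irrefl refl (ℕP.≤-trans (ℕP.≤-reflexive (sym d≡1+m))
                   (ℕP.≤-trans (d-minimal _ x y (reach-snoc (d adj x z) x z y (d-reaches x z) e)) lt))

  d-snoc-≤ : ∀ x y y′ → adj y y′ ≡ true → d adj x y′ ≤ suc (d adj x y)
  d-snoc-≤ x y y′ e = d-minimal _ x y′ (reach-snoc (d adj x y) x y y′ (d-reaches x y) e)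

  d-cons-≤ : ∀ x x′ y → adj x x′ ≡ true → d adj x y ≤ suc (d adj x′ y)
  d-cons-≤ x x′ y e = d-minimal _ x y (reach-cons (d adj x′ y) x x′ y e (d-reaches x′ y))

  toward : ∀ x y → x ≢ y → ∃ λ p → adj y p ≡ true × suc (d adj x p) ≡ d adj x y
  toward x y x≢y with d adj x y in d≡
  ... | zero  = ⊥-elim (x≢y (d≡0⇒≡ x y d≡))
  ... | suc m with d-last-step m x y d≡
  ...   | p , e , d≡m = p , trans (adj-sym y p) e , cong suc d≡m

  d-sym-≤ : ∀ m x y → d adj y x ≡ m → d adj x y ≤ m
  d-sym-≤ zero x y d≡0 rewrite d≡0⇒≡ y x d≡0 | d-refl x = z≤n
  d-sym-≤ (suc m) x y d≡1+m with d-last-step m y x d≡1+m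
  ... | z , e , d≡m = ℕP.≤-trans (d-cons-≤ x z y (trans (adj-sym x z) e)) (s≤s (d-sym-≤ m z y d≡m))

  d-sym : ∀ x y → d adj x y ≡ d adj y x
  d-sym x y = ℕP.≤-antisym (d-sym-≤ _ x y refl) (d-sym-≤ _ y x refl)

module IndexedSum (M : CommutativeMonoid 0ℓ 0ℓ) where
  open CommutativeMonoid M using (Carrier; _≈_; ∙-congˡ; identityˡ; commutativeSemigroup)
    renaming (_∙_ to _⊕_; ε to 0#)
  private module M = CommutativeMonoid M
  open import Algebra.Properties.CommutativeMonoid.Sum M public
  open import Algebra.Properties.CommutativeSemigroup commutativeSemigroup using (x∙yz≈y∙xz)

  erase : ∀ {n} → Fin n → Vector Carrier n → Vector Carrier n
  erase a f z = if ⌊ z ≟ a ⌋ then 0# else f z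

  sum-erase : ∀ {n} a (f : Vector Carrier n) → sum f ≈ f a ⊕ sum (erase a f)
  sum-erase {suc n} Fin.zero    f = ∙-congˡ (M.sym (identityˡ _))
  sum-erase {suc n} (Fin.suc a) f = M.trans (∙-congˡ (sum-erase a (f ∘ Fin.suc)))
    (M.trans (x∙yz≈y∙xz (f Fin.zero) (f (Fin.suc a)) (sum (erase a (f ∘ Fin.suc))))
             (∙-congˡ (∙-congˡ (M.reflexive (sum-cong-≗ erase-suc)))))
    where
    erase-suc : ∀ z → erase a (f ∘ Fin.suc) z ≡ erase (Fin.suc a) f (Fin.suc z)
    erase-suc z with z ≟ a
    ... | yes _ = refl
    ... | no  _ = refl

  erase-≢ : ∀ {n} a (f : Vector Carrier n) b → b ≢ a → erase a f b ≡ f b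
  erase-≢ a f b b≢a with b ≟ a
  ... | yes b≡a = ⊥-elim (b≢a b≡a)
  ... | no _    = refl

  sum-allFin : ∀ {n} (f : Vector Carrier n) → foldr (λ z acc → f z ⊕ acc) 0# (allFin n) ≡ sum f
  sum-allFin {n} f = go n id
    where
    go : ∀ m (h : Fin m → Fin n) → foldr (λ z acc → f z ⊕ acc) 0# (tabulate h) ≡ sum (f ∘ h)
    go zero    h = refl
    go (suc m) h = cong (f (h Fin.zero) ⊕_) (go m (h ∘ Fin.suc))

module ℕΣ = IndexedSum ℕP.+-0-commutativeMonoid

sum-mono-≤ : ∀ {m} {f g : Fin m → ℕ} → (∀ z → f z ≤ g z) → ℕΣ.sum f ≤ ℕΣ.sum g
sum-mono-≤ {zero}  f≤g = z≤n
sum-mono-≤ {suc m} f≤g = ℕP.+-mono-≤ (f≤g Fin.zero) (sum-mono-≤ (f≤g ∘ Fin.suc))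

term≤sum : ∀ {m} (f : Fin m → ℕ) a → f a ≤ ℕΣ.sum f
term≤sum f a = ℕP.≤-trans (ℕP.m≤m+n (f a) (ℕΣ.sum (ℕΣ.erase a f))) (ℕP.≤-reflexive (sym (ℕΣ.sum-erase a f)))

two-terms≤sum : ∀ {m} (f : Fin m → ℕ) {a b} → a ≢ b → f a + f b ≤ ℕΣ.sum f
two-terms≤sum f {a} {b} a≢b = ℕP.≤-trans
  (ℕP.+-monoʳ-≤ (f a) (ℕP.≤-trans (ℕP.≤-reflexive (sym (ℕΣ.erase-≢ a f b (a≢b ∘ sym)))) (term≤sum (ℕΣ.erase a f) b)))
  (ℕP.≤-reflexive (sym (ℕΣ.sum-erase a f)))

sum-≡-pointwise : ∀ {m} {f g : Fin m → ℕ} → (∀ z → f z ≤ g z) → ℕΣ.sum f ≡ ℕΣ.sum g → ∀ z → f z ≡ g z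
sum-≡-pointwise {suc m} {f} {g} f≤g Σf≡Σg = pointwise
  where
  head≡ : f Fin.zero ≡ g Fin.zero
  head≡ = ℕP.≤-antisym (f≤g Fin.zero)
    (ℕP.≮⇒≥ λ lt → ℕP.<-irrefl Σf≡Σg (ℕP.+-mono-<-≤ lt (sum-mono-≤ (f≤g ∘ Fin.suc))))
  tail≡ : ℕΣ.sum (f ∘ Fin.suc) ≡ ℕΣ.sum (g ∘ Fin.suc)
  tail≡ = ℕP.+-cancelˡ-≡ (f Fin.zero) _ _ (trans Σf≡Σg (cong (_+ ℕΣ.sum (g ∘ Fin.suc)) (sym head≡)))
  pointwise : ∀ z → f z ≡ g z
  pointwise Fin.zero    = head≡
  pointwise (Fin.suc z) = sum-≡-pointwise (f≤g ∘ Fin.suc) tail≡ z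

record Distinct₃ {n : ℕ} (P : Fin n → Set) : Set where
  constructor distinct₃
  field
    {a b c}   : Fin n
    Pa        : P a
    Pb        : P b
    Pc        : P c
    a≢b       : a ≢ b
    a≢c       : a ≢ c
    b≢c       : b ≢ c

module _ {n : ℕ} {P : Fin n → Set} (abc : Distinct₃ P) where
  open Distinct₃ abc

  two-avoiding : ∀ s → ∃₂ λ w₁ w₂ → P w₁ × P w₂ × w₁ ≢ w₂ × w₁ ≢ s × w₂ ≢ s
  two-avoiding s with a ≟ s | b ≟ s
  ... | yes refl | _        = b , c , Pb , Pc , b≢c , (λ { refl → a≢b refl }) , (λ { refl → a≢c refl })
  ... | no a≢s   | yes refl = a , c , Pa , Pc , a≢c , a≢s , (λ { refl → b≢c refl })
  ... | no a≢s   | no b≢s   = a , b , Pa , Pb , a≢b , a≢s , b≢s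

  one-avoiding₂ : ∀ s t → ∃ λ w → P w × w ≢ s × w ≢ t
  one-avoiding₂ s t with two-avoiding s
  ... | w₁ , w₂ , P₁ , P₂ , w₁≢w₂ , w₁≢s , w₂≢s with w₁ ≟ t
  ...   | yes refl = w₂ , P₂ , w₂≢s , (λ { refl → w₁≢w₂ refl })
  ...   | no w₁≢t  = w₁ , P₁ , w₁≢s , w₁≢t

indicator : Bool → ℕ
indicator b = if b then 1 else 0

module Degree {n : ℕ} (adj : Adj n) where

  deg≡sum : ∀ x → deg adj x ≡ ℕΣ.sum (λ y → indicator (adj x y))
  deg≡sum x = ℕΣ.sum-allFin (λ y → indicator (adj x y))

  sum-indicator-≡ : ∀ a → ℕΣ.sum (λ z → indicator ⌊ z ≟ a ⌋) ≡ 1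
  sum-indicator-≡ a = trans (ℕΣ.sum-erase a is-a) (cong₂ _+_ self (trans (ℕΣ.sum-cong-≗ others) (ℕΣ.sum-replicate-zero n)))
    where
    is-a : Fin n → ℕ
    is-a z = indicator ⌊ z ≟ a ⌋
    self : is-a a ≡ 1
    self with a ≟ a
    ... | yes _ = refl
    ... | no a≢a = ⊥-elim (a≢a refl)
    others : ∀ z → ℕΣ.erase a is-a z ≡ 0
    others z with z ≟ a
    ... | yes _ = refl
    ... | no _ = refl

  deg-≤ : ∀ y (c : Fin n → ℕ) → (∀ z → adj y z ≡ true → 1 ≤ c z) → deg adj y ≤ ℕΣ.sum c
  deg-≤ y c covers = ℕP.≤-trans (ℕP.≤-reflexive (deg≡sum y)) (sum-mono-≤ pointwise)
    where
    pointwise : ∀ z → indicator (adj y z) ≤ c z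
    pointwise z with adj y z in e
    ... | true  = covers z e
    ... | false = z≤n

  deg≤1 : ∀ y p → (∀ z → adj y z ≡ true → z ≡ p) → deg adj y ≤ 1
  deg≤1 y p only-p = ℕP.≤-trans (deg-≤ y (λ z → indicator ⌊ z ≟ p ⌋) covers) (ℕP.≤-reflexive (sum-indicator-≡ p))
    where
    covers : ∀ z → adj y z ≡ true → 1 ≤ indicator ⌊ z ≟ p ⌋
    covers z e with z ≟ p
    ... | yes _ = ℕP.≤-refl
    ... | no z≢p = ⊥-elim (z≢p (only-p z e))

  deg≤2 : ∀ y a b → (∀ z → adj y z ≡ true → z ≡ a ⊎ z ≡ b) → deg adj y ≤ 2
  deg≤2 y a b only-ab = ℕP.≤-trans (deg-≤ y c covers)
    (ℕP.≤-reflexive (trans (ℕΣ.∑-distrib-+ (λ z → indicator ⌊ z ≟ a ⌋) (λ z → indicator ⌊ z ≟ b ⌋))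
                           (cong₂ _+_ (sum-indicator-≡ a) (sum-indicator-≡ b))))
    where
    c : Fin n → ℕ
    c z = indicator ⌊ z ≟ a ⌋ + indicator ⌊ z ≟ b ⌋
    covers : ∀ z → adj y z ≡ true → 1 ≤ c z
    covers z e with z ≟ a | z ≟ b | only-ab z e
    ... | yes _ | _     | _      = s≤s z≤n
    ... | no _  | yes _ | _      = s≤s z≤n
    ... | no z≢a | no _ | inj₁ q = ⊥-elim (z≢a q)
    ... | no _  | no z≢b | inj₂ q = ⊥-elim (z≢b q)

  sum-≤-deg : ∀ y (c : Fin n → ℕ) → (∀ z → c z ≤ indicator (adj y z)) → ℕΣ.sum c ≤ deg adj y
  sum-≤-deg y c below = ℕP.≤-trans (sum-mono-≤ below) (ℕP.≤-reflexive (sym (deg≡sum y)))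

  deg≥3 : ∀ y a b c → adj y a ≡ true → adj y b ≡ true → adj y c ≡ true →
          a ≢ b → a ≢ c → b ≢ c → 3 ≤ deg adj y
  deg≥3 y a b c ea eb ec a≢b a≢c b≢c = ℕP.≤-trans (ℕP.≤-reflexive (sym three)) (sum-≤-deg y is-abc below)
    where
    is-abc : Fin n → ℕ
    is-abc z = indicator ⌊ z ≟ a ⌋ + indicator ⌊ z ≟ b ⌋ + indicator ⌊ z ≟ c ⌋
    three : ℕΣ.sum is-abc ≡ 3
    three = trans (ℕΣ.∑-distrib-+ (λ z → indicator ⌊ z ≟ a ⌋ + indicator ⌊ z ≟ b ⌋) _)
              (cong₂ _+_ (trans (ℕΣ.∑-distrib-+ (λ z → indicator ⌊ z ≟ a ⌋) _)
                                (cong₂ _+_ (sum-indicator-≡ a) (sum-indicator-≡ b)))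
                         (sum-indicator-≡ c))
    below : ∀ z → is-abc z ≤ indicator (adj y z)
    below z with z ≟ a | z ≟ b | z ≟ c
    ... | yes refl | yes refl | _        = ⊥-elim (a≢b refl)
    ... | yes refl | no _     | yes refl = ⊥-elim (a≢c refl)
    ... | yes refl | no _     | no _     rewrite ea = ℕP.≤-refl
    ... | no _     | yes refl | yes refl = ⊥-elim (b≢c refl)
    ... | no _     | yes refl | no _     rewrite eb = ℕP.≤-refl
    ... | no _     | no _     | yes refl rewrite ec = ℕP.≤-refl
    ... | no _     | no _     | no _     = z≤n

  deg≥1 : ∀ y p → adj y p ≡ true → 1 ≤ deg adj y
  deg≥1 y p e = ℕP.≤-trans (ℕP.≤-reflexive (sym (sum-indicator-≡ p))) (sum-≤-deg y (λ z → indicator ⌊ z ≟ p ⌋) below)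
    where
    below : ∀ z → indicator ⌊ z ≟ p ⌋ ≤ indicator (adj y z)
    below z with z ≟ p
    ... | yes refl rewrite e = ℕP.≤-refl
    ... | no _ = z≤n

  neighbour-outside : ∀ y {B : Fin n → Set} → (∀ z → Dec (B z)) →
                      (∃ λ z → adj y z ≡ true × ¬ B z) ⊎ (∀ z → adj y z ≡ true → B z)
  neighbour-outside y B? with Fin.any? (λ z → (adj y z Bool.≟ true) ×-dec ¬? (B? z))
  ... | yes (z , e , ¬Bz) = inj₁ (z , e , ¬Bz)
  ... | no ∄z = inj₂ λ z e → decidable-stable (B? z) (λ ¬Bz → ∄z (z , e , ¬Bz))

  major-neighbours : ∀ y → IsMajor adj y → Distinct₃ (λ z → adj y z ≡ true)
  major-neighbours y major with neighbour-outside y {λ _ → ⊥} (λ _ → no λ ())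
  ... | inj₂ none = ⊥-elim (ℕP.<⇒≱ major (ℕP.≤-trans (deg≤1 y y (λ z e → ⊥-elim (none z e))) (s≤s z≤n)))
  ... | inj₁ (a , ea , _) with neighbour-outside y (_≟ a)
  ...   | inj₂ only-a = ⊥-elim (ℕP.<⇒≱ major (ℕP.≤-trans (deg≤1 y a only-a) (s≤s z≤n)))
  ...   | inj₁ (b , eb , b≢a) with neighbour-outside y (λ z → (z ≟ a) ⊎-dec (z ≟ b))
  ...     | inj₂ only-ab = ⊥-elim (ℕP.<⇒≱ major (deg≤2 y a b only-ab))
  ...     | inj₁ (c , ec , c∉ab) =
    distinct₃ ea eb ec (λ { refl → b≢a refl }) (λ { refl → c∉ab (inj₁ refl) }) (λ { refl → c∉ab (inj₂ refl) })

sum-const-1 : ∀ m → ℕΣ.sum {m} (λ _ → 1) ≡ m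
sum-const-1 zero    = refl
sum-const-1 (suc m) = cong suc (sum-const-1 m)

handshake-arith : ∀ a L E → a ≤ L → 2 * a ≡ L + E + L → E ≡ 0 × L ≡ a
handshake-arith a L E a≤L 2a≡L+E+L with ℕP.m≤n⇒∃[o]m+o≡n a≤L
... | o , refl = E≡0 , trans (cong (a +_) o≡0) (ℕP.+-identityʳ a)
  where
  rearranged : (a + a) + ((o + o) + E) ≡ (a + a) + 0
  rearranged = trans (lhs a o E) (trans (sym 2a≡L+E+L) (rhs a))
    where
    lhs : ∀ a o E → (a + a) + ((o + o) + E) ≡ (a + o) + E + (a + o)
    lhs = solve-∀
    rhs : ∀ a → 2 * a ≡ (a + a) + 0
    rhs = solve-∀
  excess≡0 : (o + o) + E ≡ 0
  excess≡0 = ℕP.+-cancelˡ-≡ (a + a) _ _ rearranged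
  E≡0 : E ≡ 0
  E≡0 = ℕP.m+n≡0⇒n≡0 (o + o) excess≡0
  o≡0 : o ≡ 0
  o≡0 = ℕP.m+n≡0⇒m≡0 o (ℕP.m+n≡0⇒m≡0 (o + o) excess≡0)

module Layering {n : ℕ} (adj : Adj n) (adj-sym : ∀ x y → adj x y ≡ adj y x)
                (connected : ∀ x y → T (reach adj n x y))
                (edges : sumℕ adj (deg adj) ≡ 2 * (n ∸ 1)) (r : Fin n) where
  open Distance adj adj-sym connected
  open Degree adj

  depth : Fin n → ℕ
  depth = d adj r

  down level up : Fin n → Fin n → ℕ
  down x y  = indicator (adj x y ∧ ⌊ depth y <? depth x ⌋)
  level x y = indicator (adj x y ∧ ⌊ depth x ℕP.≟ depth y ⌋)
  up x y    = indicator (adj x y ∧ ⌊ depth x <? depth y ⌋)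

  edge-split : ∀ x y → indicator (adj x y) ≡ down x y + level x y + up x y
  edge-split x y with adj x y
  ... | false = refl
  ... | true with depth y <? depth x | depth x ℕP.≟ depth y | depth x <? depth y
  ...   | yes _   | no _    | no _    = refl
  ...   | no _    | yes _   | no _    = refl
  ...   | no _    | no _    | yes _   = refl
  ...   | yes y<x | yes x≡y | _       = ⊥-elim (ℕP.<-irrefl (sym x≡y) y<x)
  ...   | yes y<x | no _    | yes x<y = ⊥-elim (ℕP.<-asym y<x x<y)
  ...   | no _    | yes x≡y | yes x<y = ⊥-elim (ℕP.<-irrefl x≡y x<y)
  ...   | no y≮x  | no x≢y  | no x≮y  = ⊥-elim (x≢y (ℕP.≤-antisym (ℕP.≮⇒≥ y≮x) (ℕP.≮⇒≥ x≮y)))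

  parents : Fin n → ℕ
  parents x = ℕΣ.sum (down x)

  Down Level Up : ℕ
  Down  = ℕΣ.sum parents
  Level = ℕΣ.sum (λ x → ℕΣ.sum (level x))
  Up    = ℕΣ.sum (λ x → ℕΣ.sum (up x))

  degree-sum : sumℕ adj (deg adj) ≡ Down + Level + Up
  degree-sum = begin
    sumℕ adj (deg adj)                                          ≡⟨ ℕΣ.sum-allFin (deg adj) ⟩
    ℕΣ.sum (deg adj)                                             ≡⟨ ℕΣ.sum-cong-≗ per-vertex ⟩
    ℕΣ.sum (λ x → ℕΣ.sum (down x) + ℕΣ.sum (level x) + ℕΣ.sum (up x))
      ≡⟨ trans (ℕΣ.∑-distrib-+ (λ x → ℕΣ.sum (down x) + ℕΣ.sum (level x)) _)
               (cong (_+ Up) (ℕΣ.∑-distrib-+ parents _)) ⟩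
    Down + Level + Up                                            ∎
    where
    open ≡-Reasoning
    per-vertex : ∀ x → deg adj x ≡ ℕΣ.sum (down x) + ℕΣ.sum (level x) + ℕΣ.sum (up x)
    per-vertex x = trans (deg≡sum x) (trans (ℕΣ.sum-cong-≗ (edge-split x))
      (trans (ℕΣ.∑-distrib-+ (λ y → down x y + level x y) (up x)) (cong (_+ ℕΣ.sum (up x)) (ℕΣ.∑-distrib-+ (down x) (level x)))))

  Up≡Down : Up ≡ Down
  Up≡Down = trans (ℕΣ.sum-cong-≗ λ x → ℕΣ.sum-cong-≗ (up≡down-flipped x)) (ℕΣ.∑-comm (λ x y → down y x))
    where
    up≡down-flipped : ∀ x y → up x y ≡ down y x
    up≡down-flipped x y rewrite adj-sym x y = refl

  nonroot : Fin n → ℕ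
  nonroot = ℕΣ.erase r (λ _ → 1)

  sum-nonroot : ℕΣ.sum nonroot ≡ n ∸ 1
  sum-nonroot = sym (cong (_∸ 1) (trans (sym (sum-const-1 n)) (ℕΣ.sum-erase r (λ _ → 1))))

  nonroot≤1 : ∀ x → nonroot x ≤ 1
  nonroot≤1 x with x ≟ r
  ... | yes _ = z≤n
  ... | no  _ = ℕP.≤-refl

  down≡1 : ∀ {x y} → adj x y ≡ true → depth y < depth x → down x y ≡ 1
  down≡1 {x} {y} e y<x rewrite e with depth y <? depth x
  ... | yes _  = refl
  ... | no y≮x = ⊥-elim (y≮x y<x)

  parent : ∀ x → x ≢ r → ∃ λ y → down x y ≡ 1
  parent x x≢r = below (depth x) refl
    where
    below : ∀ k → depth x ≡ k → ∃ λ y → down x y ≡ 1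
    below zero    depth≡0 = ⊥-elim (x≢r (sym (d≡0⇒≡ r x depth≡0)))
    below (suc m) depth≡ with d-last-step m r x depth≡
    ... | y , e , depth-y =
      y , down≡1 (trans (adj-sym x y) e) (subst₂ _<_ (sym depth-y) (sym depth≡) (ℕP.n<1+n m))

  has-parent : ∀ x → nonroot x ≤ parents x
  has-parent x with x ≟ r
  ... | yes _  = z≤n
  ... | no x≢r with parent x x≢r
  ...   | y , down-xy = ℕP.≤-trans (ℕP.≤-reflexive (sym down-xy)) (term≤sum (down x) y)

  edge-counts : Level ≡ 0 × Down ≡ n ∸ 1
  edge-counts = handshake-arith (n ∸ 1) Down Level
    (ℕP.≤-trans (ℕP.≤-reflexive (sym sum-nonroot)) (sum-mono-≤ has-parent))
    (trans (sym edges) (trans degree-sum (cong (Down + Level +_) Up≡Down)))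

  no-level-edge : ∀ x y → adj x y ≡ true → depth x ≢ depth y
  no-level-edge x y e x≡y = ℕP.<⇒≱ (s≤s z≤n) (begin
    1                                ≡⟨ sym level-xy ⟩
    level x y                        ≤⟨ term≤sum (level x) y ⟩
    ℕΣ.sum (level x)                 ≤⟨ term≤sum (λ x → ℕΣ.sum (level x)) x ⟩
    Level                            ≡⟨ proj₁ edge-counts ⟩
    0                                ∎)
    where
    open ℕP.≤-Reasoning
    level-xy : level x y ≡ 1
    level-xy rewrite e with depth x ℕP.≟ depth y
    ... | yes _ = refl
    ... | no x≢y = ⊥-elim (x≢y x≡y)

  lower-neighbour-unique : ∀ x y₁ y₂ → adj x y₁ ≡ true → adj x y₂ ≡ true →
                           depth y₁ < depth x → depth y₂ < depth x → y₁ ≡ y₂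
  lower-neighbour-unique x y₁ y₂ e₁ e₂ y₁<x y₂<x with y₁ ≟ y₂
  ... | yes y₁≡y₂ = y₁≡y₂
  ... | no y₁≢y₂ = ⊥-elim (ℕP.<⇒≱ (s≤s (s≤s z≤n)) (begin
    2                         ≡⟨ sym (cong₂ _+_ (down≡1 e₁ y₁<x) (down≡1 e₂ y₂<x)) ⟩
    down x y₁ + down x y₂     ≤⟨ two-terms≤sum (down x) y₁≢y₂ ⟩
    parents x                 ≡⟨ parents≡nonroot ⟩
    nonroot x                 ≤⟨ nonroot≤1 x ⟩
    1                         ∎))
    where
    open ℕP.≤-Reasoning
    parents≡nonroot : parents x ≡ nonroot x
    parents≡nonroot = sym (sum-≡-pointwise has-parent (trans sum-nonroot (sym (proj₂ edge-counts))) x)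

argmax : ∀ {n} {P : Fin n → Set} → (∀ z → Dec (P z)) → (f : Fin n → ℕ) → ∃ P →
         ∃ λ y → P y × (∀ z → P z → f z ≤ f y)
argmax {suc n} {P} P? f (x , Px) with Fin.any? (P? ∘ Fin.suc)
... | no ∄ = Fin.zero , P0 x Px , λ { Fin.zero _ → ℕP.≤-refl ; (Fin.suc z) Pz → ⊥-elim (∄ (z , Pz)) }
  where
  P0 : ∀ x → P x → P Fin.zero
  P0 Fin.zero    Px = Px
  P0 (Fin.suc x) Px = ⊥-elim (∄ (x , Px))
... | yes ∃P with argmax (P? ∘ Fin.suc) (f ∘ Fin.suc) ∃P
...   | y , Py , max with P? Fin.zero | f Fin.zero ℕP.≤? f (Fin.suc y)
...     | yes P0 | no f0≰ = Fin.zero , P0 , λ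
          { Fin.zero _ → ℕP.≤-refl ; (Fin.suc z) Pz → ℕP.≤-trans (max z Pz) (ℕP.<⇒≤ (ℕP.≰⇒> f0≰)) }
...     | yes _  | yes f0≤ = Fin.suc y , Py , λ { Fin.zero _ → f0≤ ; (Fin.suc z) Pz → max z Pz }
...     | no ¬P0 | _       = Fin.suc y , Py , λ { Fin.zero P0 → ⊥-elim (¬P0 P0) ; (Fin.suc z) Pz → max z Pz }

module TreeGeometry {n : ℕ} (adj : Adj n) (adj-sym : ∀ x y → adj x y ≡ adj y x)
                    (connected : ∀ x y → T (reach adj n x y))
                    (edges : sumℕ adj (deg adj) ≡ 2 * (n ∸ 1)) where
  open Distance adj adj-sym connected public
  open Degree adj
  private module L = Layering adj adj-sym connected edges

  adjacent-d : ∀ u w z → adj u w ≡ true → d adj z w ≡ suc (d adj z u) ⊎ d adj z u ≡ suc (d adj z w)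
  adjacent-d u w z e with ℕP.<-cmp (d adj z u) (d adj z w)
  ... | tri< u<w _ _ = inj₁ (ℕP.≤-antisym (d-snoc-≤ z u w e) u<w)
  ... | tri≈ _ u≡w _ = ⊥-elim (L.no-level-edge z u w e u≡w)
  ... | tri> _ _ w<u = inj₂ (ℕP.≤-antisym (d-snoc-≤ z w u (trans (adj-sym w u) e)) w<u)

  closer-neighbour-unique : ∀ z x y₁ y₂ → adj x y₁ ≡ true → adj x y₂ ≡ true →
                            d adj z y₁ < d adj z x → d adj z y₂ < d adj z x → y₁ ≡ y₂
  closer-neighbour-unique z = L.lower-neighbour-unique z

  d-adjacent : ∀ x y → adj x y ≡ true → d adj x y ≡ 1
  d-adjacent x y e with adjacent-d x y x e
  ... | inj₁ d≡ = trans d≡ (cong suc (d-refl x))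
  ... | inj₂ d≡ = case trans (sym (d-refl x)) d≡ of λ ()

  OnSide : Fin n → Fin n → Fin n → Set
  OnSide a b z = d adj z a < d adj z b

  OnSide-≢ : ∀ {a b z} → OnSide a b z → z ≢ b
  OnSide-≢ {a} {b} z-side refl = ℕP.n≮0 (subst (d adj b a <_) (d-refl b) z-side)

  module Gate {a b : Fin n} (ab : adj a b ≡ true) where

    toward-a-stays : ∀ m z z′ → OnSide a b z → d adj a z ≡ suc m → adj z′ z ≡ true → d adj a z′ ≡ m →
                     OnSide a b z′
    toward-a-stays m z z′ z-side az≡ e az′≡ with adjacent-d a b z′ ab
    ... | inj₁ b≡ = subst (d adj z′ a <_) (sym b≡) (ℕP.n<1+n _)
    ... | inj₂ a≡ = ⊥-elim (ℕP.<-asym z-side (begin-strict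
      d adj z b             ≤⟨ d-cons-≤ z z′ b (trans (adj-sym z z′) e) ⟩
      suc (d adj z′ b)      ≡⟨ trans (sym a≡) (trans (d-sym z′ a) az′≡) ⟩
      m                     <⟨ ℕP.n<1+n m ⟩
      suc m                 ≡⟨ trans (sym az≡) (d-sym a z) ⟩
      d adj z a             ∎))
      where open ℕP.≤-Reasoning

    module _ {x : Fin n} (x-side : OnSide b a x) where

      xa≡ : d adj x a ≡ suc (d adj x b)
      xa≡ with adjacent-d a b x ab
      ... | inj₁ b≡ = ⊥-elim (ℕP.<-asym x-side (subst (d adj x a <_) (sym b≡) (ℕP.n<1+n _)))
      ... | inj₂ a≡ = a≡

      Through : ℕ → Set
      Through m = ∀ z → d adj a z ≡ m → OnSide a b z → d adj x z ≡ suc (d adj x b + m)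

      -- Along a shortest path from a to z every step moves away from x: otherwise the previous
      -- vertex would have two different neighbours closer to x.
      through-step : ∀ m → (∀ {k} → k < m → Through k) → Through m
      through-step zero    _  z az≡0 _ rewrite sym (d≡0⇒≡ a z az≡0) = trans xa≡ (cong suc (sym (ℕP.+-identityʳ _)))
      through-step (suc m) ih z az≡ z-side with d-last-step m a z az≡
      ... | z′ , e , az′≡ with toward-a-stays m z z′ z-side az≡ e az′≡ | adjacent-d z′ z x e
      ...   | z′-side | inj₁ z≡ = trans z≡ (cong suc (trans (ih (ℕP.n<1+n m) z′ az′≡ z′-side) (sym (ℕP.+-suc _ m))))
      ...   | z′-side | inj₂ z′≡ = ⊥-elim (no-second-closer m refl)
        where
        z-closer : d adj x z < d adj x z′
        z-closer = subst (d adj x z <_) (sym z′≡) (ℕP.n<1+n _)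
        no-second-closer : ∀ k → m ≡ k → ⊥
        no-second-closer zero refl with d≡0⇒≡ a z′ az′≡
        ... | refl with closer-neighbour-unique x a z b e ab z-closer x-side
        ...   | refl = ℕP.n≮0 (subst (d adj b a <_) (d-refl b) z-side)
        no-second-closer (suc k) refl with d-last-step k a z′ az′≡
        ... | z₂ , e₂ , az₂≡ = ℕP.m≢1+n+m k {1} (trans (sym az₂≡) (trans (cong (d adj a) z₂≡z) az≡))
          where
          xz₂≡ : d adj x z₂ ≡ suc (d adj x b + k)
          xz₂≡ = ih (ℕP.≤-trans (ℕP.n<1+n k) (ℕP.n≤1+n _)) z₂ az₂≡ (toward-a-stays k z′ z₂ z′-side az′≡ e₂ az₂≡)
          z₂-closer : d adj x z₂ < d adj x z′
          z₂-closer = subst₂ _<_ (sym xz₂≡) (sym (trans (ih (ℕP.n<1+n m) z′ az′≡ z′-side) (cong suc (ℕP.+-suc _ k)))) (ℕP.n<1+n _)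
          z₂≡z : z₂ ≡ z
          z₂≡z = closer-neighbour-unique x z′ z₂ z (trans (adj-sym z′ z₂) e₂) e z₂-closer z-closer

      through : ∀ z → OnSide a b z → d adj x z ≡ suc (d adj x b + d adj a z)
      through z z-side = <-rec Through through-step (d adj a z) z refl z-side

  beyond-edge-farther : ∀ {c w ℓ w′} → adj c w ≡ true → OnSide c w ℓ → OnSide w c w′ → w′ ≢ w →
                        d adj ℓ w < d adj ℓ w′
  beyond-edge-farther {c} {w} {ℓ} {w′} cw ℓ-side w′-side w′≢w = subst₂ _<_ (d-sym w ℓ) (d-sym w′ ℓ) (begin-strict
    d adj w ℓ                      ≡⟨ Gate.through cw w-side ℓ ℓ-side ⟩
    suc (d adj w w + d adj c ℓ)    ≡⟨ cong (λ t → suc (t + d adj c ℓ)) (d-refl w) ⟩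
    suc (d adj c ℓ)                <⟨ s≤s (ℕP.+-monoˡ-< (d adj c ℓ) (ℕP.n≢0⇒n>0 (w′≢w ∘ d≡0⇒≡ w′ w))) ⟩
    suc (d adj w′ w + d adj c ℓ)   ≡⟨ sym (Gate.through cw w′-side ℓ ℓ-side) ⟩
    d adj w′ ℓ                     ∎)
    where
    open ℕP.≤-Reasoning
    w-side : OnSide w c w
    w-side rewrite d-refl w | d-adjacent w c (trans (adj-sym w c) cw) = s≤s z≤n

  far-leaf : ∀ a b → adj a b ≡ true →
             ∃ λ ℓ → OnSide a b ℓ × IsLeaf adj ℓ × (∀ z → OnSide a b z → d adj b z ≤ d adj b ℓ)
  far-leaf a b ab with argmax (λ z → d adj z a <? d adj z b) (d adj b) (a , a-side)
    where
    a-side : OnSide a b a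
    a-side rewrite d-refl a | d-adjacent a b ab = s≤s z≤n
  ... | ℓ , ℓ-side , max with toward b ℓ b≢ℓ
    where
    b≢ℓ : b ≢ ℓ
    b≢ℓ refl = ℕP.n≮0 (subst (d adj b a <_) (d-refl b) ℓ-side)
  ...   | p , ℓp , p-closer = ℓ , ℓ-side , ℕP.≤-antisym (deg≤1 ℓ p only-p) (deg≥1 ℓ p ℓp) , max
    where
    only-p : ∀ y → adj ℓ y ≡ true → y ≡ p
    only-p y ℓy with adjacent-d ℓ y b ℓy
    ... | inj₂ y-closer = closer-neighbour-unique b ℓ y p ℓy ℓp
                            (subst (d adj b y <_) (sym y-closer) (ℕP.n<1+n _))
                            (subst (d adj b p <_) p-closer (ℕP.n<1+n _))
    ... | inj₁ y-farther with adjacent-d a b y ab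
    ...   | inj₁ y-on-a = ⊥-elim (ℕP.<⇒≱ (subst (d adj b ℓ <_) (sym y-farther) (ℕP.n<1+n _))
                                         (max y (subst (d adj y a <_) (sym y-on-a) (ℕP.n<1+n _))))
    ...   | inj₂ y-on-b = ⊥-elim (ℕP.1+n≢0 (trans (sym y-farther) (ℕP.m+n≡0⇒n≡0 (d adj ℓ a) (sym (ℕP.suc-injective ℓy≡)))))
      where
      ℓy≡ : 1 ≡ suc (d adj ℓ a + d adj b y)
      ℓy≡ = trans (sym (d-adjacent ℓ y ℓy))
                  (Gate.through (trans (adj-sym b a) ab) ℓ-side y (subst (d adj y b <_) (sym y-on-b) (ℕP.n<1+n _)))

module Spider {n : ℕ} (adj : Adj n) (adj-sym : ∀ x y → adj x y ≡ adj y x)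
               (connected : ∀ x y → T (reach adj n x y))
               (edges : sumℕ adj (deg adj) ≡ 2 * (n ∸ 1))
               (v : Fin n) (v-major : IsMajor adj v)
               (exterior-unique : ∀ w → IsExteriorMajor adj w → w ≡ v) where
  open TreeGeometry adj adj-sym connected edges public
  open Degree adj

  away-from-v : ∀ y p c → adj y p ≡ true → suc (d adj v p) ≡ d adj v y →
                adj y c ≡ true → c ≢ p → d adj v c ≡ suc (d adj v y)
  away-from-v y p c yp p-closer yc c≢p with adjacent-d y c v yc
  ... | inj₁ c-farther = c-farther
  ... | inj₂ c-closer  = ⊥-elim (c≢p (closer-neighbour-unique v y c p yc yp
                           (subst (d adj v c <_) (sym c-closer) (ℕP.n<1+n _))
                           (subst (d adj v p <_) p-closer (ℕP.n<1+n _))))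

  no-other-major : ∀ w → IsMajor adj w → w ≡ v
  no-other-major w w-major with w ≟ v
  ... | yes w≡v = w≡v
  ... | no w≢v with argmax (λ w → ¬? (w ≟ v) ×-dec (3 ℕP.≤? deg adj w)) (d adj v) (w , w≢v , w-major)
  ...   | w* , (w*≢v , w*-major) , farthest with toward v w* (w*≢v ∘ sym)
  ...     | p , w*p , p-closer with one-avoiding₂ (major-neighbours w* w*-major) p p
  ...       | c , w*c , c≢p , _ with far-leaf c w* (trans (adj-sym c w*) w*c)
  ...         | ℓ , ℓ-side , ℓ-leaf , _ = ⊥-elim (w*≢v (exterior-unique w* (w*-major , ℓ , w*-major , ℓ-leaf , terminal)))
    where
    cw* : adj c w* ≡ true
    cw* = trans (adj-sym c w*) w*c
    v-side : OnSide w* c v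
    v-side = subst (d adj v w* <_) (sym (away-from-v w* p c w*p p-closer w*c c≢p)) (ℕP.n<1+n _)
    terminal : ∀ w″ → IsMajor adj w″ → w″ ≢ w* → d adj ℓ w* < d adj ℓ w″
    terminal w″ w″-major w″≢w* with adjacent-d c w* w″ cw*
    ... | inj₁ w″-on-c = ⊥-elim (ℕP.<⇒≱ beyond (farthest w″ (w″≢v , w″-major)))
      where
      v≡ : d adj v w″ ≡ suc (d adj v w* + d adj c w″)
      v≡ = Gate.through cw* v-side w″ (subst (d adj w″ c <_) (sym w″-on-c) (ℕP.n<1+n _))
      beyond : d adj v w* < d adj v w″
      beyond = subst (d adj v w* <_) (sym v≡) (s≤s (ℕP.m≤m+n _ _))
      w″≢v : w″ ≢ v
      w″≢v refl = ℕP.1+n≢0 (trans (sym v≡) (d-refl v))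
    ... | inj₂ w*-on-w″ = beyond-edge-farther cw* ℓ-side (subst (d adj w″ w* <_) (sym w*-on-w″) (ℕP.n<1+n _)) w″≢w*

  branch-of : ∀ z → z ≢ v → ∃ λ u → adj v u ≡ true × OnSide u v z
  branch-of z z≢v with toward z v z≢v
  ... | u , vu , u-closer = u , vu , subst (d adj z u <_) u-closer (ℕP.n<1+n _)

  branch-unique : ∀ {u₁ u₂ z} → adj v u₁ ≡ true → adj v u₂ ≡ true → OnSide u₁ v z → OnSide u₂ v z → u₁ ≡ u₂
  branch-unique {u₁} {u₂} {z} = closer-neighbour-unique z v u₁ u₂

  on-branch : ∀ {u z} → adj v u ≡ true → OnSide u v z → d adj z v ≡ suc (d adj z u)
  on-branch {u} {z} vu z-side with adjacent-d v u z vu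
  ... | inj₁ u≡ = ⊥-elim (ℕP.<-asym z-side (subst (d adj z v <_) (sym u≡) (ℕP.n<1+n _)))
  ... | inj₂ v≡ = v≡

  off-branch : ∀ {u z} → adj v u ≡ true → ¬ OnSide u v z → d adj z u ≡ suc (d adj z v)
  off-branch {u} {z} vu ¬z-side with adjacent-d v u z vu
  ... | inj₁ u≡ = u≡
  ... | inj₂ v≡ = ⊥-elim (¬z-side (subst (d adj z u <_) (sym v≡) (ℕP.n<1+n _)))

  branch-depth : ∀ {u z} → adj v u ≡ true → OnSide u v z → d adj v z ≡ suc (d adj u z)
  branch-depth {u} {z} vu z-side = trans (d-sym v z) (trans (on-branch vu z-side) (cong suc (d-sym z u)))

  across : ∀ {u x z} → adj v u ≡ true → OnSide u v z → ¬ OnSide u v x → d adj x z ≡ d adj x v + d adj v z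
  across {u} {x} {z} vu z-side ¬x-side = begin
    d adj x z                   ≡⟨ Gate.through (trans (adj-sym u v) vu) x-side z z-side ⟩
    suc (d adj x v + d adj u z) ≡⟨ sym (ℕP.+-suc (d adj x v) (d adj u z)) ⟩
    d adj x v + suc (d adj u z) ≡⟨ cong (d adj x v +_) (sym (branch-depth vu z-side)) ⟩
    d adj x v + d adj v z       ∎
    where
    open ≡-Reasoning
    x-side : OnSide v u x
    x-side = subst (d adj x v <_) (sym (off-branch vu ¬x-side)) (ℕP.n<1+n _)

  branch-parent : ∀ {u m z z′} → adj v u ≡ true → OnSide u v z → d adj u z ≡ suc m →
                  adj z′ z ≡ true → d adj u z′ ≡ m → OnSide u v z′
  branch-parent {u} {m} {z} {z′} vu = Gate.toward-a-stays (trans (adj-sym u v) vu) m z z′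

  at-most-one-child : ∀ p x y → p ≢ v → adj p x ≡ true → adj p y ≡ true →
                      d adj v x ≡ suc (d adj v p) → d adj v y ≡ suc (d adj v p) → x ≡ y
  at-most-one-child p x y p≢v px py x-child y-child with x ≟ y
  ... | yes x≡y = x≡y
  ... | no x≢y with toward v p (p≢v ∘ sym)
  ...   | q , pq , q-parent = ⊥-elim (p≢v (no-other-major p (deg≥3 p x y q px py pq x≢y (≢parent x-child) (≢parent y-child))))
    where
    ≢parent : ∀ {z} → d adj v z ≡ suc (d adj v p) → z ≢ q
    ≢parent {z} z-child refl = ℕP.m≢1+n+m (d adj v z) {1} (trans z-child (cong suc (sym q-parent)))

  branch-is-path : ∀ {u} m x y → adj v u ≡ true → OnSide u v x → OnSide u v y →
                   d adj u x ≡ m → d adj u y ≡ m → x ≡ y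
  branch-is-path zero x y _ _ _ ux≡0 uy≡0 = trans (sym (d≡0⇒≡ _ x ux≡0)) (d≡0⇒≡ _ y uy≡0)
  branch-is-path {u} (suc m) x y vu x-side y-side ux≡ uy≡
    with d-last-step m u x ux≡ | d-last-step m u y uy≡
  ... | px , px-x , upx≡ | py , py-y , upy≡
    with branch-parent vu x-side ux≡ px-x upx≡ | branch-parent vu y-side uy≡ py-y upy≡
  ...   | px-side | py-side with branch-is-path m px py vu px-side py-side upx≡ upy≡
  ...     | refl = at-most-one-child px x y (OnSide-≢ px-side) px-x py-y (child x-side ux≡) (child y-side uy≡)
    where
    child : ∀ {z} → OnSide u v z → d adj u z ≡ suc m → d adj v z ≡ suc (d adj v px)
    child z-side uz≡ = trans (branch-depth vu z-side)
                         (cong suc (trans uz≡ (sym (trans (branch-depth vu px-side) (cong suc upx≡)))))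

  branch-ancestor : ∀ {u} j t z → adj v u ≡ true → OnSide u v z → d adj u z ≡ j + t →
                    ∃ λ y → OnSide u v y × d adj u y ≡ j
  branch-ancestor j zero z _ z-side uz≡ = z , z-side , trans uz≡ (ℕP.+-identityʳ j)
  branch-ancestor j (suc t) z vu z-side uz≡ with d-last-step (j + t) _ z (trans uz≡ (ℕP.+-suc j t))
  ... | z′ , z′z , uz′≡ =
    branch-ancestor j t z′ vu (branch-parent vu z-side (trans uz≡ (ℕP.+-suc j t)) z′z uz′≡) uz′≡

  eccentricity-≤ : ∀ k → (∀ ℓ → IsTerminal adj v ℓ → d adj v ℓ ≤ k) → ∀ z → d adj v z ≤ k
  eccentricity-≤ k terminal-bound z with z ≟ v
  ... | yes refl = subst (_≤ k) (sym (d-refl v)) z≤n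
  ... | no z≢v with branch-of z z≢v
  ...   | u , vu , z-side with far-leaf u v (trans (adj-sym u v) vu)
  ...     | ℓ , _ , ℓ-leaf , farthest = ℕP.≤-trans (farthest z z-side) (terminal-bound ℓ ℓ-terminal)
    where
    ℓ-terminal : IsTerminal adj v ℓ
    ℓ-terminal = v-major , ℓ-leaf , λ w w-major w≢v → ⊥-elim (w≢v (no-other-major w w-major))

module ℚΣ = IndexedSum ℚP.+-0-commutativeMonoid

Nonneg : ∀ {n} → (Fin n → ℚ) → Set
Nonneg g = ∀ z → 0ℚ ℚ.≤ g z

sumℚ-mono-≤ : ∀ {m} {f g : Fin m → ℚ} → (∀ z → f z ℚ.≤ g z) → ℚΣ.sum f ℚ.≤ ℚΣ.sum g
sumℚ-mono-≤ {zero}  f≤g = ℚP.≤-refl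
sumℚ-mono-≤ {suc m} f≤g = ℚP.+-mono-≤ (f≤g Fin.zero) (sumℚ-mono-≤ (f≤g ∘ Fin.suc))

sumℚ-nonneg : ∀ {m} {f : Fin m → ℚ} → Nonneg f → 0ℚ ℚ.≤ ℚΣ.sum f
sumℚ-nonneg {m} f≥0 = ℚP.≤-trans (ℚP.≤-reflexive (sym (ℚΣ.sum-replicate-zero m))) (sumℚ-mono-≤ f≥0)

erase-nonneg : ∀ {m} {f : Fin m → ℚ} a → Nonneg f → Nonneg (ℚΣ.erase a f)
erase-nonneg a f≥0 z with z ≟ a
... | yes _ = ℚP.≤-refl
... | no  _ = f≥0 z

term≤sumℚ : ∀ {m} (f : Fin m → ℚ) a → Nonneg f → f a ℚ.≤ ℚΣ.sum f
term≤sumℚ f a f≥0 = begin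
  f a                              ≡⟨ sym (ℚP.+-identityʳ (f a)) ⟩
  f a ℚ.+ 0ℚ                       ≤⟨ ℚP.+-monoʳ-≤ (f a) (sumℚ-nonneg (erase-nonneg a f≥0)) ⟩
  f a ℚ.+ ℚΣ.sum (ℚΣ.erase a f)    ≡⟨ sym (ℚΣ.sum-erase a f) ⟩
  ℚΣ.sum f                         ∎
  where open ℚP.≤-Reasoning

two-terms≤sumℚ : ∀ {m} (f : Fin m → ℚ) {a b} → a ≢ b → Nonneg f → f a ℚ.+ f b ℚ.≤ ℚΣ.sum f
two-terms≤sumℚ f {a} {b} a≢b f≥0 = begin
  f a ℚ.+ f b                      ≡⟨ cong (f a ℚ.+_) (sym (ℚΣ.erase-≢ a f b (a≢b ∘ sym))) ⟩
  f a ℚ.+ ℚΣ.erase a f b           ≤⟨ ℚP.+-monoʳ-≤ (f a) (term≤sumℚ (ℚΣ.erase a f) b (erase-nonneg a f≥0)) ⟩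
  f a ℚ.+ ℚΣ.sum (ℚΣ.erase a f)    ≡⟨ sym (ℚΣ.sum-erase a f) ⟩
  ℚΣ.sum f                         ∎
  where open ℚP.≤-Reasoning

restrict : ∀ {n} → (Fin n → Bool) → (Fin n → ℚ) → Fin n → ℚ
restrict P g z = if P z then g z else 0ℚ

restrict-nonneg : ∀ {n} (P : Fin n → Bool) {g} → Nonneg g → Nonneg (restrict P g)
restrict-nonneg P g≥0 z with P z
... | true  = g≥0 z
... | false = ℚP.≤-refl

restrict-true : ∀ {n} (P : Fin n → Bool) g {z} → P z ≡ true → restrict P g z ≡ g z
restrict-true P g Pz rewrite Pz = refl

½+½≡1 : ½ ℚ.+ ½ ≡ 1ℚ
½+½≡1 = refl

sum-restrict-two : ∀ {m} (P : Fin m → Bool) g {a b} → a ≢ b → P a ≡ true → P b ≡ true →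
                   ℚΣ.sum (restrict P g) ≡ (g a ℚ.+ g b) ℚ.+ ℚΣ.sum (ℚΣ.erase b (ℚΣ.erase a (restrict P g)))
sum-restrict-two P g {a} {b} a≢b Pa Pb = begin
  ℚΣ.sum (restrict P g)                                        ≡⟨ ℚΣ.sum-erase a (restrict P g) ⟩
  restrict P g a ℚ.+ ℚΣ.sum (ℚΣ.erase a (restrict P g))         ≡⟨ cong (restrict P g a ℚ.+_) (ℚΣ.sum-erase b (ℚΣ.erase a (restrict P g))) ⟩
  restrict P g a ℚ.+ (ℚΣ.erase a (restrict P g) b ℚ.+ rest)    ≡⟨ cong₂ (λ s t → s ℚ.+ (t ℚ.+ rest)) (restrict-true P g Pa)
                                                                   (trans (ℚΣ.erase-≢ a (restrict P g) b (a≢b ∘ sym)) (restrict-true P g Pb)) ⟩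
  g a ℚ.+ (g b ℚ.+ rest)                                        ≡⟨ sym (ℚP.+-assoc (g a) (g b) rest) ⟩
  (g a ℚ.+ g b) ℚ.+ rest                                        ∎
  where
  open ≡-Reasoning
  rest : ℚ
  rest = ℚΣ.sum (ℚΣ.erase b (ℚΣ.erase a (restrict P g)))

-- At most one element of P can weigh less than ½, and any partner of it makes up the deficit.
half-bound : ∀ {m} (P : Fin m → Bool) (f : Fin m → ℚ) →
             (∀ a b → P a ≡ true → P b ≡ true → a ≢ b → 1ℚ ℚ.≤ f a ℚ.+ f b) →
             ∀ {a₀ b₀} → P a₀ ≡ true → P b₀ ≡ true → a₀ ≢ b₀ →
             ℚΣ.sum (restrict P (λ _ → ½)) ℚ.≤ ℚΣ.sum (restrict P f)
half-bound P f pair≥1 {a₀} {b₀} Pa₀ Pb₀ a₀≢b₀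
  with Fin.any? (λ a → (P a Bool.≟ true) ×-dec (f a ℚP.<? ½))
... | no ∄small = sumℚ-mono-≤ pointwise
  where
  pointwise : ∀ z → restrict P (λ _ → ½) z ℚ.≤ restrict P f z
  pointwise z with P z in Pz
  ... | true  = ℚP.≮⇒≥ (λ fz<½ → ∄small (z , Pz , fz<½))
  ... | false = ℚP.≤-refl
... | yes (a , Pa , fa<½) with partner
  where
  partner : ∃ λ b → P b ≡ true × a ≢ b
  partner with a ≟ a₀
  ... | no a≢a₀ = a₀ , Pa₀ , a≢a₀
  ... | yes refl = b₀ , Pb₀ , a₀≢b₀
...   | b , Pb , a≢b = begin
  ℚΣ.sum (restrict P (λ _ → ½))           ≡⟨ sum-restrict-two P (λ _ → ½) a≢b Pa Pb ⟩
  (½ ℚ.+ ½) ℚ.+ ℚΣ.sum (rest (λ _ → ½))   ≤⟨ ℚP.+-mono-≤ (ℚP.≤-trans (ℚP.≤-reflexive ½+½≡1) (pair≥1 a b Pa Pb a≢b))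
                                                        (sumℚ-mono-≤ pointwise) ⟩
  (f a ℚ.+ f b) ℚ.+ ℚΣ.sum (rest f)        ≡⟨ sym (sum-restrict-two P f a≢b Pa Pb) ⟩
  ℚΣ.sum (restrict P f)                   ∎
  where
  open ℚP.≤-Reasoning
  rest : (Fin _ → ℚ) → Fin _ → ℚ
  rest g = ℚΣ.erase b (ℚΣ.erase a (restrict P g))
  at-least-½ : ∀ z → P z ≡ true → a ≢ z → ½ ℚ.≤ f z
  at-least-½ z Pz a≢z = ℚP.≮⇒≥ λ fz<½ → ℚP.<-irrefl refl (ℚP.≤-<-trans (pair≥1 a z Pa Pz a≢z)
                          (subst (f a ℚ.+ f z ℚ.<_) ½+½≡1 (ℚP.+-mono-< fa<½ fz<½)))
  pointwise : ∀ z → rest (λ _ → ½) z ℚ.≤ rest f z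
  pointwise z with z ≟ b
  ... | yes _ = ℚP.≤-refl
  ... | no _ with z ≟ a
  ...   | yes _ = ℚP.≤-refl
  ...   | no z≢a with P z in Pz
  ...     | true  = at-least-½ z Pz (z≢a ∘ sym)
  ...     | false = ℚP.≤-refl

module Weights {n : ℕ} (adj : Adj n) where

  weightOn≡sum : ∀ P g → weightOn adj P g ≡ ℚΣ.sum (restrict P g)
  weightOn≡sum P g = go n id
    where
    step : ∀ z acc → (if P z then g z ℚ.+ acc else acc) ≡ restrict P g z ℚ.+ acc
    step z acc with P z
    ... | true  = refl
    ... | false = sym (ℚP.+-identityˡ acc)
    go : ∀ m (h : Fin m → Fin n) →
         foldr (λ z acc → if P z then g z ℚ.+ acc else acc) 0ℚ (tabulate h) ≡ ℚΣ.sum (restrict P g ∘ h)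
    go zero    h = refl
    go (suc m) h = trans (step (h Fin.zero) _) (cong (restrict P g (h Fin.zero) ℚ.+_) (go m (h ∘ Fin.suc)))

  weight≡sum : ∀ g → weight adj g ≡ ℚΣ.sum g
  weight≡sum = weightOn≡sum (λ _ → true)

  weightOn-mono : ∀ P Q {g} → (∀ z → P z ≡ true → Q z ≡ true) → Nonneg g → weightOn adj P g ℚ.≤ weightOn adj Q g
  weightOn-mono P Q {g} P⊆Q g≥0 =
    subst₂ ℚ._≤_ (sym (weightOn≡sum P g)) (sym (weightOn≡sum Q g)) (sumℚ-mono-≤ pointwise)
    where
    pointwise : ∀ z → restrict P g z ℚ.≤ restrict Q g z
    pointwise z with P z in Pz
    ... | true rewrite P⊆Q z Pz = ℚP.≤-refl
    ... | false = restrict-nonneg Q g≥0 z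

  weightOn-∪ : ∀ P P₁ P₂ {g} → (∀ z → P z ≡ true → P₁ z ≡ true ⊎ P₂ z ≡ true) → Nonneg g →
               weightOn adj P g ℚ.≤ weightOn adj P₁ g ℚ.+ weightOn adj P₂ g
  weightOn-∪ P P₁ P₂ {g} P⊆P₁∪P₂ g≥0 =
    subst₂ ℚ._≤_ (sym (weightOn≡sum P g)) (sym (cong₂ ℚ._+_ (weightOn≡sum P₁ g) (weightOn≡sum P₂ g)))
      (ℚP.≤-trans (sumℚ-mono-≤ pointwise) (ℚP.≤-reflexive (ℚΣ.∑-distrib-+ (restrict P₁ g) (restrict P₂ g))))
    where
    g₁≥0 : Nonneg (restrict P₁ g)
    g₁≥0 = restrict-nonneg P₁ g≥0
    g₂≥0 : Nonneg (restrict P₂ g)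
    g₂≥0 = restrict-nonneg P₂ g≥0
    pointwise : ∀ z → restrict P g z ℚ.≤ restrict P₁ g z ℚ.+ restrict P₂ g z
    pointwise z with P z in Pz
    ... | false = ℚP.+-mono-≤ (g₁≥0 z) (g₂≥0 z)
    ... | true with P⊆P₁∪P₂ z Pz
    ...   | inj₁ P₁z rewrite P₁z = ℚP.≤-trans (ℚP.≤-reflexive (sym (ℚP.+-identityʳ (g z)))) (ℚP.+-monoʳ-≤ (g z) (g₂≥0 z))
    ...   | inj₂ P₂z rewrite P₂z = ℚP.≤-trans (ℚP.≤-reflexive (sym (ℚP.+-identityˡ (g z)))) (ℚP.+-monoˡ-≤ (g z) (g₁≥0 z))

  weightOn-two : ∀ P {g a b} → a ≢ b → P a ≡ true → P b ≡ true → Nonneg g → g a ℚ.+ g b ℚ.≤ weightOn adj P g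
  weightOn-two P {g} {a} {b} a≢b Pa Pb g≥0 =
    subst₂ ℚ._≤_ (cong₂ ℚ._+_ (restrict-true P g Pa) (restrict-true P g Pb)) (sym (weightOn≡sum P g))
      (two-terms≤sumℚ (restrict P g) a≢b (restrict-nonneg P g≥0))

  R[k]⇒R : ∀ k x y z → R[_] adj k x y z ≡ true → R adj x y z ≡ true
  R[k]⇒R k x y z Rₖ = ≢⇒≢ᵇ {d adj x z} {d adj y z} λ eq → ≢ᵇ⇒≢ {d adj x z ℕ.⊓ suc k} Rₖ (cong (ℕ._⊓ suc k) eq)

  trunc⇒resolving : ∀ k h → IsTruncResolvingFunction adj k h → IsResolvingFunction adj h
  trunc⇒resolving k h (h-unit , h-res) =
    h-unit , λ x y x≢y → ℚP.≤-trans (h-res x y x≢y) (weightOn-mono (R[_] adj k x y) (R adj x y) (R[k]⇒R k x y) (proj₁ ∘ h-unit))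

  weightOn-single : ∀ v g → weightOn adj (λ z → ⌊ z ≟ v ⌋) g ≡ g v
  weightOn-single v g = begin
    weightOn adj (λ z → ⌊ z ≟ v ⌋) g                    ≡⟨ weightOn≡sum _ g ⟩
    ℚΣ.sum (restrict (λ z → ⌊ z ≟ v ⌋) g)                ≡⟨ ℚΣ.sum-erase v _ ⟩
    restrict (λ z → ⌊ z ≟ v ⌋) g v ℚ.+ ℚΣ.sum (ℚΣ.erase v (restrict (λ z → ⌊ z ≟ v ⌋) g))
      ≡⟨ cong₂ ℚ._+_ self (trans (ℚΣ.sum-cong-≗ others) (ℚΣ.sum-replicate-zero n)) ⟩
    g v ℚ.+ 0ℚ                                          ≡⟨ ℚP.+-identityʳ (g v) ⟩
    g v                                                 ∎
    where
    open ≡-Reasoning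
    self : restrict (λ z → ⌊ z ≟ v ⌋) g v ≡ g v
    self with v ≟ v
    ... | yes _ = refl
    ... | no v≢v = ⊥-elim (v≢v refl)
    others : ∀ z → ℚΣ.erase v (restrict (λ z → ⌊ z ≟ v ⌋) g) z ≡ 0ℚ
    others z with z ≟ v
    ... | yes _ = refl
    ... | no _  = refl

module SpiderResolving {n : ℕ} (adj : Adj n) (adj-sym : ∀ x y → adj x y ≡ adj y x)
                       (connected : ∀ x y → T (reach adj n x y))
                       (edges : sumℕ adj (deg adj) ≡ 2 * (n ∸ 1))
                       (v : Fin n) (v-major : IsMajor adj v)
                       (exterior-unique : ∀ w → IsExteriorMajor adj w → w ≡ v) where
  open Spider adj adj-sym connected edges v v-major exterior-unique public
  open Degree adj using (major-neighbours)

  Resolves : Fin n → Fin n → Fin n → Set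
  Resolves x y u = adj v u ≡ true × d adj x u ≢ d adj y u

  TwoResolvers : Fin n → Fin n → Set
  TwoResolvers x y = ∃₂ λ u₁ u₂ → u₁ ≢ u₂ × Resolves x y u₁ × Resolves x y u₂

  neighbours : Distinct₃ (λ u → adj v u ≡ true)
  neighbours = major-neighbours v v-major

  v-on-no-branch : ∀ {u} → ¬ OnSide u v v
  v-on-no-branch v-side = OnSide-≢ v-side refl

  other-branch : ∀ {u u′ z} → adj v u ≡ true → adj v u′ ≡ true → OnSide u v z → u′ ≢ u → ¬ OnSide u′ v z
  other-branch vu vu′ z-side u′≢u z-side′ = u′≢u (branch-unique vu′ vu z-side′ z-side)

  d-to-v-positive : ∀ {z} → z ≢ v → d adj z v ≢ 0
  d-to-v-positive z≢v = z≢v ∘ d≡0⇒≡ _ v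

  resolves-off : ∀ {u x y} → adj v u ≡ true → ¬ OnSide u v x → ¬ OnSide u v y →
                 d adj x v ≢ d adj y v → Resolves x y u
  resolves-off vu ¬x-side ¬y-side xv≢yv =
    vu , λ xu≡yu → xv≢yv (ℕP.suc-injective (trans (sym (off-branch vu ¬x-side)) (trans xu≡yu (off-branch vu ¬y-side))))

  resolves-split : ∀ {u x y} → adj v u ≡ true → OnSide u v x → ¬ OnSide u v y →
                   d adj x v ≢ suc (suc (d adj y v)) → Resolves x y u
  resolves-split vu x-side ¬y-side xv≢yv+2 =
    vu , λ xu≡yu → xv≢yv+2 (trans (on-branch vu x-side) (cong suc (trans xu≡yu (off-branch vu ¬y-side))))

  swap-resolves : ∀ {x y u} → Resolves x y u → Resolves y x u
  swap-resolves (vu , r) = vu , r ∘ sym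

  swap-resolvers : ∀ {x y} → TwoResolvers x y → TwoResolvers y x
  swap-resolvers (u₁ , u₂ , u₁≢u₂ , r₁ , r₂) = u₁ , u₂ , u₁≢u₂ , swap-resolves r₁ , swap-resolves r₂

  resolvers-from-v : ∀ y → y ≢ v → TwoResolvers v y
  resolvers-from-v y y≢v with branch-of y y≢v
  ... | uy , vuy , y-side with two-avoiding neighbours uy
  ...   | w₁ , w₂ , vw₁ , vw₂ , w₁≢w₂ , w₁≢uy , w₂≢uy = w₁ , w₂ , w₁≢w₂ , resolves w₁ vw₁ w₁≢uy , resolves w₂ vw₂ w₂≢uy
    where
    resolves : ∀ w → adj v w ≡ true → w ≢ uy → Resolves v y w
    resolves w vw w≢uy = resolves-off vw v-on-no-branch (other-branch vuy vw y-side w≢uy)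
                           (λ vv≡yv → d-to-v-positive y≢v (trans (sym vv≡yv) (d-refl v)))

  resolvers-equidistant : ∀ x y → x ≢ y → x ≢ v → y ≢ v → d adj x v ≡ d adj y v → TwoResolvers x y
  resolvers-equidistant x y x≢y x≢v y≢v xv≡yv with branch-of x x≢v | branch-of y y≢v
  ... | ux , vux , x-side | uy , vuy , y-side with ux ≟ uy
  ...   | yes refl = ⊥-elim (x≢y (branch-is-path _ x y vux x-side y-side refl
                       (ℕP.suc-injective (trans (sym (branch-depth vux y-side))
                         (trans (d-sym v y) (trans (sym xv≡yv) (trans (d-sym x v) (branch-depth vux x-side))))))))
  ...   | no ux≢uy = ux , uy , ux≢uy ,
    resolves-split vux x-side (other-branch vuy vux y-side ux≢uy) (no-jump xv≡yv) ,
    swap-resolves (resolves-split vuy y-side (other-branch vux vuy x-side (ux≢uy ∘ sym)) (no-jump (sym xv≡yv)))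
    where
    no-jump : ∀ {a b} → a ≡ b → a ≢ suc (suc b)
    no-jump refl = ℕP.m≢1+n+m _ {1}

  resolvers-not-equidistant : ∀ x y → x ≢ v → y ≢ v → d adj x v ≢ d adj y v → TwoResolvers x y
  resolvers-not-equidistant x y x≢v y≢v xv≢yv with branch-of x x≢v | branch-of y y≢v
  ... | ux , vux , x-side | uy , vuy , y-side with ux ≟ uy
  ...   | yes refl with two-avoiding neighbours ux
  ...     | w₁ , w₂ , vw₁ , vw₂ , w₁≢w₂ , w₁≢u , w₂≢u =
    w₁ , w₂ , w₁≢w₂ ,
    resolves-off vw₁ (other-branch vux vw₁ x-side w₁≢u) (other-branch vux vw₁ y-side w₁≢u) xv≢yv ,
    resolves-off vw₂ (other-branch vux vw₂ x-side w₂≢u) (other-branch vux vw₂ y-side w₂≢u) xv≢yv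
  resolvers-not-equidistant x y x≢v y≢v xv≢yv | ux , vux , x-side | uy , vuy , y-side | no ux≢uy
    with one-avoiding₂ neighbours ux uy | d adj x v ℕP.≟ suc (suc (d adj y v))
  ... | w , vw , w≢ux , w≢uy | no xv≢yv+2 =
    w , ux , w≢ux , resolves-off vw (other-branch vux vw x-side w≢ux) (other-branch vuy vw y-side w≢uy) xv≢yv ,
    resolves-split vux x-side (other-branch vuy vux y-side ux≢uy) xv≢yv+2
  ... | w , vw , w≢ux , w≢uy | yes xv≡yv+2 =
    w , uy , w≢uy , resolves-off vw (other-branch vux vw x-side w≢ux) (other-branch vuy vw y-side w≢uy) xv≢yv ,
    swap-resolves (resolves-split vuy y-side (other-branch vux vuy x-side (ux≢uy ∘ sym)) yv≢xv+2)
    where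
    yv≢xv+2 : d adj y v ≢ suc (suc (d adj x v))
    yv≢xv+2 yv≡ = ℕP.m≢1+n+m (d adj y v) {3} (trans yv≡ (cong (suc ∘ suc) xv≡yv+2))

  resolvers : ∀ x y → x ≢ y → TwoResolvers x y
  resolvers x y x≢y with x ≟ v | y ≟ v
  ... | yes refl | yes refl = ⊥-elim (x≢y refl)
  ... | yes refl | no y≢v   = resolvers-from-v y y≢v
  ... | no x≢v   | yes refl = swap-resolvers (resolvers-from-v x x≢v)
  ... | no x≢v   | no y≢v   with d adj x v ℕP.≟ d adj y v
  ...   | yes xv≡yv = resolvers-equidistant x y x≢y x≢v y≢v xv≡yv
  ...   | no xv≢yv  = resolvers-not-equidistant x y x≢v y≢v xv≢yv

  open Weights adj

  onBranch : Fin n → Fin n → Bool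
  onBranch u z = ⌊ d adj z u <? d adj z v ⌋

  onBranch⁺ : ∀ {u z} → OnSide u v z → onBranch u z ≡ true
  onBranch⁺ {u} {z} z-side with d adj z u <? d adj z v
  ... | yes _ = refl
  ... | no ¬z-side = ⊥-elim (¬z-side z-side)

  onBranch⁻ : ∀ {u z} → onBranch u z ≡ true → OnSide u v z
  onBranch⁻ {u} {z} e with d adj z u <? d adj z v
  ... | yes z-side = z-side

  offBranch⁻ : ∀ {u z} → onBranch u z ≡ false → ¬ OnSide u v z
  offBranch⁻ e z-side = case trans (sym (onBranch⁺ z-side)) e of λ ()

  branchWeight : (Fin n → ℚ) → Fin n → ℚ
  branchWeight h u = weightOn adj (onBranch u) h

  weight-by-branches : ∀ h → weight adj h ≡ h v ℚ.+ ℚΣ.sum (restrict (adj v) (branchWeight h))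
  weight-by-branches h = begin
    weight adj h                                          ≡⟨ weight≡sum h ⟩
    ℚΣ.sum h                                              ≡⟨ ℚΣ.sum-erase v h ⟩
    h v ℚ.+ ℚΣ.sum (ℚΣ.erase v h)                         ≡⟨ cong (h v ℚ.+_) (sym (ℚΣ.sum-cong-≗ column)) ⟩
    h v ℚ.+ ℚΣ.sum (λ z → ℚΣ.sum (λ u → F u z))           ≡⟨ cong (h v ℚ.+_) (sym (ℚΣ.∑-comm F)) ⟩
    h v ℚ.+ ℚΣ.sum (λ u → ℚΣ.sum (F u))                   ≡⟨ cong (h v ℚ.+_) (ℚΣ.sum-cong-≗ row) ⟩
    h v ℚ.+ ℚΣ.sum (restrict (adj v) (branchWeight h))    ∎
    where
    open ≡-Reasoning
    F : Fin n → Fin n → ℚ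
    F u z = if adj v u then restrict (onBranch u) h z else 0ℚ
    row : ∀ u → ℚΣ.sum (F u) ≡ restrict (adj v) (branchWeight h) u
    row u with adj v u
    ... | true  = sym (weightOn≡sum (onBranch u) h)
    ... | false = ℚΣ.sum-replicate-zero n
    F≡0 : ∀ u z → ¬ (adj v u ≡ true × OnSide u v z) → F u z ≡ 0ℚ
    F≡0 u z ¬contributes with adj v u | onBranch u z in uz
    ... | false | _     = refl
    ... | true  | false = refl
    ... | true  | true  = ⊥-elim (¬contributes (refl , onBranch⁻ uz))
    column : ∀ z → ℚΣ.sum (λ u → F u z) ≡ ℚΣ.erase v h z
    column z with z ≟ v
    ... | yes refl = trans (ℚΣ.sum-cong-≗ (λ u → F≡0 u v (v-on-no-branch ∘ proj₂))) (ℚΣ.sum-replicate-zero n)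
    ... | no z≢v with branch-of z z≢v
    ...   | u₀ , vu₀ , z-side = begin
      ℚΣ.sum (λ u → F u z)                             ≡⟨ ℚΣ.sum-erase u₀ (λ u → F u z) ⟩
      F u₀ z ℚ.+ ℚΣ.sum (ℚΣ.erase u₀ (λ u → F u z))    ≡⟨ cong₂ ℚ._+_ F-u₀ (trans (ℚΣ.sum-cong-≗ others) (ℚΣ.sum-replicate-zero n)) ⟩
      h z ℚ.+ 0ℚ                                       ≡⟨ ℚP.+-identityʳ (h z) ⟩
      h z                                              ∎
      where
      F-u₀ : F u₀ z ≡ h z
      F-u₀ rewrite vu₀ | onBranch⁺ z-side = refl
      others : ∀ u → ℚΣ.erase u₀ (λ u → F u z) u ≡ 0ℚ
      others u with u ≟ u₀
      ... | yes _   = refl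
      ... | no u≢u₀ = F≡0 u z λ (vu , z-side′) → u≢u₀ (branch-unique vu vu₀ z-side′ z-side)

  branch-pair-bound : ∀ h → IsResolvingFunction adj h → ∀ u u′ → adj v u ≡ true → adj v u′ ≡ true → u ≢ u′ →
                      1ℚ ℚ.≤ branchWeight h u ℚ.+ branchWeight h u′
  branch-pair-bound h (h-unit , h-res) u u′ vu vu′ u≢u′ =
    ℚP.≤-trans (h-res u u′ u≢u′) (weightOn-∪ (R adj u u′) (onBranch u) (onBranch u′) split (proj₁ ∘ h-unit))
    where
    split : ∀ z → R adj u u′ z ≡ true → onBranch u z ≡ true ⊎ onBranch u′ z ≡ true
    split z Rz with onBranch u z in uz | onBranch u′ z in u′z
    ... | true  | _     = inj₁ refl
    ... | false | true  = inj₂ refl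
    ... | false | false = ⊥-elim (≢ᵇ⇒≢ Rz (begin
      d adj u z       ≡⟨ d-sym u z ⟩
      d adj z u       ≡⟨ off-branch vu (offBranch⁻ uz) ⟩
      suc (d adj z v) ≡⟨ sym (off-branch vu′ (offBranch⁻ u′z)) ⟩
      d adj z u′      ≡⟨ d-sym z u′ ⟩
      d adj u′ z      ∎))
      where open ≡-Reasoning

  half : Fin n → ℚ
  half = restrict (adj v) (λ _ → ½)

  half-minimal : ∀ h → IsResolvingFunction adj h → weight adj half ℚ.≤ weight adj h
  half-minimal h h-res@(h-unit , _) = begin
    weight adj half                                            ≡⟨ weight≡sum half ⟩
    ℚΣ.sum half                                                ≤⟨ half-bound (adj v) (branchWeight h) (branch-pair-bound h h-res) Pa Pb a≢b ⟩
    ℚΣ.sum (restrict (adj v) (branchWeight h))                 ≤⟨ ℚP.≤-trans (ℚP.≤-reflexive (sym (ℚP.+-identityˡ _)))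
                                                                    (ℚP.+-monoˡ-≤ _ (proj₁ (h-unit v))) ⟩
    h v ℚ.+ ℚΣ.sum (restrict (adj v) (branchWeight h))         ≡⟨ sym (weight-by-branches h) ⟩
    weight adj h                                               ∎
    where
    open ℚP.≤-Reasoning
    open Distinct₃ neighbours

  half-beaten : ∀ h → IsResolvingFunction adj h → ∀ u₀ → adj v u₀ ≡ true →
                1ℚ ℚ.≤ h v ℚ.+ branchWeight h u₀ → weight adj half ℚ.< weight adj h
  half-beaten h h-res u₀ vu₀ one≤ with two-avoiding neighbours u₀
  ... | w₁ , w₂ , vw₁ , vw₂ , w₁≢w₂ , w₁≢u₀ , w₂≢u₀ = begin-strict
    weight adj half                                  ≡⟨ trans (weight≡sum half) (split-off (λ _ → ½)) ⟩
    ½ ℚ.+ ℚΣ.sum (restrict others (λ _ → ½))         <⟨ ℚP.+-mono-<-≤ ½<1 (half-bound others (branchWeight h) pair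
                                                          (others⁺ vw₁ w₁≢u₀) (others⁺ vw₂ w₂≢u₀) w₁≢w₂) ⟩
    1ℚ ℚ.+ ℚΣ.sum (restrict others (branchWeight h)) ≤⟨ ℚP.+-monoˡ-≤ _ one≤ ⟩
    (h v ℚ.+ branchWeight h u₀) ℚ.+ ℚΣ.sum (restrict others (branchWeight h))
      ≡⟨ ℚP.+-assoc (h v) (branchWeight h u₀) _ ⟩
    h v ℚ.+ (branchWeight h u₀ ℚ.+ ℚΣ.sum (restrict others (branchWeight h)))
      ≡⟨ cong (h v ℚ.+_) (sym (split-off (branchWeight h))) ⟩
    h v ℚ.+ ℚΣ.sum (restrict (adj v) (branchWeight h)) ≡⟨ sym (weight-by-branches h) ⟩
    weight adj h                                     ∎
    where
    open ℚP.≤-Reasoning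
    ½<1 : ½ ℚ.< 1ℚ
    ½<1 = toWitness {a? = ½ ℚP.<? 1ℚ} _
    others : Fin n → Bool
    others z = adj v z ∧ not ⌊ z ≟ u₀ ⌋
    others⁺ : ∀ {w} → adj v w ≡ true → w ≢ u₀ → others w ≡ true
    others⁺ {w} vw w≢u₀ rewrite vw with w ≟ u₀
    ... | yes w≡u₀ = ⊥-elim (w≢u₀ w≡u₀)
    ... | no _     = refl
    pair : ∀ a b → others a ≡ true → others b ≡ true → a ≢ b → 1ℚ ℚ.≤ branchWeight h a ℚ.+ branchWeight h b
    pair a b oa ob = branch-pair-bound h h-res a b (proj₁ (∧-≡true⁻ oa)) (proj₁ (∧-≡true⁻ ob))
    split-off : ∀ g → ℚΣ.sum (restrict (adj v) g) ≡ g u₀ ℚ.+ ℚΣ.sum (restrict others g)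
    split-off g = trans (ℚΣ.sum-erase u₀ (restrict (adj v) g))
                        (cong₂ ℚ._+_ (restrict-true (adj v) g vu₀) (ℚΣ.sum-cong-≗ pointwise))
      where
      pointwise : ∀ z → ℚΣ.erase u₀ (restrict (adj v) g) z ≡ restrict others g z
      pointwise z with z ≟ u₀ | adj v z
      ... | yes _ | true  = refl
      ... | yes _ | false = refl
      ... | no _  | true  = refl
      ... | no _  | false = refl

  half-in-unit : InUnit adj half
  half-in-unit z with adj v z
  ... | true  = toWitness {a? = 0ℚ ℚP.≤? ½} _ , toWitness {a? = ½ ℚP.≤? 1ℚ} _
  ... | false = ℚP.≤-refl , toWitness {a? = 0ℚ ℚP.≤? 1ℚ} _

  half-trunc-resolving : ∀ k → (∀ z → d adj v z ≤ k) → IsTruncResolvingFunction adj k half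
  half-trunc-resolving k near = half-in-unit , λ x y x≢y → two (resolvers x y x≢y)
    where
    truncation-harmless : ∀ x {u} → adj v u ≡ true → d[_] adj k x u ≡ d adj x u
    truncation-harmless x {u} vu = ℕP.m≤n⇒m⊓n≡m (ℕP.≤-trans (d-snoc-≤ x v u vu) (s≤s (subst (_≤ k) (d-sym v x) (near x))))
    truncated : ∀ {x y u} → Resolves x y u → R[_] adj k x y u ≡ true
    truncated {x} {y} (vu , r) = ≢⇒≢ᵇ λ eq → r (trans (sym (truncation-harmless x vu)) (trans eq (truncation-harmless y vu)))
    two : ∀ {x y} → TwoResolvers x y → 1ℚ ℚ.≤ weightOn adj (R[_] adj k x y) half
    two {x} {y} (u₁ , u₂ , u₁≢u₂ , r₁ , r₂) =
      subst (ℚ._≤ weightOn adj (R[_] adj k x y) half)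
        (trans (cong₂ ℚ._+_ (restrict-true (adj v) (λ _ → ½) (proj₁ r₁)) (restrict-true (adj v) (λ _ → ½) (proj₁ r₂))) ½+½≡1)
        (weightOn-two (R[_] adj k x y) u₁≢u₂ (truncated r₁) (truncated r₂) (proj₁ ∘ half-in-unit))

  half-resolving : IsResolvingFunction adj half
  half-resolving = trunc⇒resolving n half (half-trunc-resolving n (d≤n v))

  off-branch-far : ∀ {u₀ x k} → adj v u₀ ≡ true → OnSide u₀ v x → k ≤ d adj v x →
                   ∀ y → y ≢ v → ¬ OnSide u₀ v y → suc k ≤ d adj x y
  off-branch-far {u₀} {x} {k} vu₀ x-side k≤vx y y≢v ¬y-side with branch-of y y≢v
  ... | u′ , vu′ , y-side = begin
    suc k                       ≡⟨ ℕP.+-comm 1 k ⟩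
    k + 1                       ≤⟨ ℕP.+-mono-≤ (subst (k ≤_) (d-sym v x) k≤vx) (ℕP.n≢0⇒n>0 (d-to-v-positive y≢v ∘ trans (d-sym y v))) ⟩
    d adj x v + d adj v y       ≡⟨ sym (across vu′ y-side (other-branch vu₀ vu′ x-side u′≢u₀)) ⟩
    d adj x y                   ∎
    where
    open ℕP.≤-Reasoning
    u′≢u₀ : u′ ≢ u₀
    u′≢u₀ refl = ¬y-side y-side

  truncated-pair-in-branch : ∀ k u₀ x₁ x₂ → adj v u₀ ≡ true → OnSide u₀ v x₁ → OnSide u₀ v x₂ →
                             d adj v x₁ ≡ k → d adj v x₂ ≡ suc k →
                             ∀ h → IsTruncResolvingFunction adj k h → 1ℚ ℚ.≤ h v ℚ.+ branchWeight h u₀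
  truncated-pair-in-branch k u₀ x₁ x₂ vu₀ x₁-side x₂-side vx₁≡ vx₂≡ h (h-unit , h-res) = begin
    1ℚ                                                         ≤⟨ h-res x₁ x₂ x₁≢x₂ ⟩
    weightOn adj (R[_] adj k x₁ x₂) h                          ≤⟨ weightOn-∪ (R[_] adj k x₁ x₂) (λ y → ⌊ y ≟ v ⌋) (onBranch u₀)
                                                                    inside (proj₁ ∘ h-unit) ⟩
    weightOn adj (λ y → ⌊ y ≟ v ⌋) h ℚ.+ branchWeight h u₀    ≡⟨ cong (ℚ._+ branchWeight h u₀) (weightOn-single v h) ⟩
    h v ℚ.+ branchWeight h u₀                                  ∎
    where
    open ℚP.≤-Reasoning
    x₁≢x₂ : x₁ ≢ x₂
    x₁≢x₂ refl = ℕP.1+n≢n (trans (sym vx₂≡) vx₁≡)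
    inside : ∀ y → R[_] adj k x₁ x₂ y ≡ true → ⌊ y ≟ v ⌋ ≡ true ⊎ onBranch u₀ y ≡ true
    inside y Rₖ with y ≟ v | onBranch u₀ y in u₀y
    ... | yes _  | _     = inj₁ refl
    ... | no _   | true  = inj₂ refl
    ... | no y≢v | false = ⊥-elim (≢ᵇ⇒≢ Rₖ (trans (capped x₁-side (ℕP.≤-reflexive (sym vx₁≡)))
                                                 (sym (capped x₂-side (ℕP.≤-trans (ℕP.n≤1+n k) (ℕP.≤-reflexive (sym vx₂≡)))))))
      where
      capped : ∀ {x} → OnSide u₀ v x → k ≤ d adj v x → d[_] adj k x y ≡ suc k
      capped x-side k≤vx = ℕP.m≥n⇒m⊓n≡n (off-branch-far vu₀ x-side k≤vx y y≢v (offBranch⁻ u₀y))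

  far-vertex-beats-half : ∀ k → 1 ≤ k → ∀ z → k < d adj v z → ∀ h → IsTruncResolvingFunction adj k h →
                          weight adj half ℚ.< weight adj h
  far-vertex-beats-half (suc j) _ z k<vz h h-trunc with z ≟ v
  ... | yes refl = ⊥-elim (ℕP.n≮0 (subst (suc j <_) (d-refl v) k<vz))
  ... | no z≢v with branch-of z z≢v
  ...   | u₀ , vu₀ , z-side with ancestor j (ℕP.n≤1+n j) | ancestor (suc j) ℕP.≤-refl
    where
    k≤u₀z : suc j ≤ d adj u₀ z
    k≤u₀z = ℕP.≤-pred (subst (suc j <_) (branch-depth vu₀ z-side) k<vz)
    ancestor : ∀ i → i ≤ suc j → ∃ λ x → OnSide u₀ v x × d adj u₀ x ≡ i
    ancestor i i≤k = branch-ancestor i _ z vu₀ z-side (sym (ℕP.m+[n∸m]≡n (ℕP.≤-trans i≤k k≤u₀z)))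
  ... | x₁ , x₁-side , u₀x₁≡ | x₂ , x₂-side , u₀x₂≡ =
    half-beaten h (trunc⇒resolving (suc j) h h-trunc) u₀ vu₀
      (truncated-pair-in-branch (suc j) u₀ x₁ x₂ vu₀ x₁-side x₂-side
        (trans (branch-depth vu₀ x₁-side) (cong suc u₀x₁≡)) (trans (branch-depth vu₀ x₂-side) (cong suc u₀x₂≡)) h h-trunc)

proposition3p18 : (n : ℕ) (adj : Adj n) → IsTree adj →
    (k : ℕ) → 1 ≤ k →
    (v : Fin n) → IsExteriorMajor adj v → (∀ w → IsExteriorMajor adj w → w ≡ v) →
    (r s : ℚ) → IsFracDim adj r → IsTruncFracDim adj k s →
    ((s ≡ r) ⇔ (∀ ℓ → IsTerminal adj v ℓ → d adj v ℓ ≤ k))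
proposition3p18 n adj (adj-sym , _ , connected , _ , edges) k 1≤k v (v-major , _) exterior-unique r s
  ((g , g-resolving , g≡r) , r-minimal) ((h , h-trunc , h≡s) , s-minimal) = mk⇔ legs-short legs-short⇒s≡r
  where
  open SpiderResolving adj adj-sym connected edges v v-major exterior-unique
  open Weights adj using (trunc⇒resolving)

  r≡half : r ≡ weight adj half
  r≡half = ℚP.≤-antisym (r-minimal half half-resolving) (ℚP.≤-trans (half-minimal g g-resolving) (ℚP.≤-reflexive g≡r))

  legs-short⇒s≡r : (∀ ℓ → IsTerminal adj v ℓ → d adj v ℓ ≤ k) → s ≡ r
  legs-short⇒s≡r short = ℚP.≤-antisym
    (ℚP.≤-trans (s-minimal half (half-trunc-resolving k (eccentricity-≤ k short))) (ℚP.≤-reflexive (sym r≡half)))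
    (ℚP.≤-trans (r-minimal h (trunc⇒resolving k h h-trunc)) (ℚP.≤-reflexive h≡s))

  legs-short : s ≡ r → ∀ ℓ → IsTerminal adj v ℓ → d adj v ℓ ≤ k
  legs-short s≡r ℓ _ with d adj v ℓ ℕP.≤? k
  ... | yes ℓ-near = ℓ-near
  ... | no ℓ-far = ⊥-elim (ℚP.<-irrefl (trans (sym r≡half) (trans (sym s≡r) (sym h≡s)))
                                       (far-vertex-beats-half k 1≤k ℓ (ℕP.≰⇒> ℓ-far) h h-trunc))
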